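{- For every integer $m \geq 0$ define $$E(m) = s(m) + \sum_{k=1}^{\infty} (-1)^k \bigl[ s(m - 3k^2 + k) + s(m - 3k^2 - k) \bigr],$$ where $s(h) = 0$ for $h < 0$. Then: $E(m) = 1$ if $m = \tfrac12 l(l+1)$ with $l = 0$ or $l \geq 3$, or if $m = \tfrac12 l(l+1) + 2$ with $l \geq 2$; $E(m) = -1$ if $m = 1$ or $m = 2$; $E(m) = -2$ if $m = \tfrac12 l(l+1) + 1$ with $l \geq 2$; and $E(m) = 0$ if $m \geq 6$ and none of $m$, $m-1$, $m-2$ equals $\tfrac12 l(l+1)$ for some integer $l \geq 3$.
   Context: For $n \geq 0$ let $q(n)$ be the number of partitions of $n$ into distinct parts, with $q(0)=1$, and set $q(n)=0$ for $n<0$. The butterfly sequence is $s(n) = q(n) - 2q(n-1) + q(n-2)$ for $n \geq 0$. -}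

module Defs where

open import Data.Nat using (ℕ; zero; suc; _+_; _*_; _∸_; _<_; _≤_; _≤ᵇ_)
open import Data.Integer as ℤ using (ℤ; +_; -_)
open import Data.List using (List; []; _∷_; _++_; length; map; applyUpTo)
open import Data.Bool using (if_then_else_)

-- distPartsBelow b n : all partitions of n into distinct parts, each part < b,
-- as strictly decreasing lists.
distPartsBelow : ℕ → ℕ → List (List ℕ)
distPartsBelow zero zero = [] ∷ []
distPartsBelow zero (suc n) = []
distPartsBelow (suc b) n =
  distPartsBelow b n ++ largest b
  where
  largest : ℕ → List (List ℕ)
  largest zero = []
  largest (suc a) = if suc a ≤ᵇ n then map (suc a ∷_) (distPartsBelow (suc a) (n ∸ suc a)) else []

q : ℕ → ℕ
q n = length (distPartsBelow (suc n) n)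

qℤ : ℤ → ℤ
qℤ (+ n) = + q n
qℤ ℤ.-[1+ n ] = + 0

s : ℤ → ℤ
s (+ n) = qℤ (+ n) ℤ.- (+ 2) ℤ.* qℤ (+ n ℤ.- + 1) ℤ.+ qℤ (+ n ℤ.- + 2)
s ℤ.-[1+ n ] = + 0

sgn : ℕ → ℤ
sgn zero = + 1
sgn (suc k) = - sgn k

term : ℕ → ℕ → ℤ
term m k = sgn k ℤ.* (s (+ m ℤ.- + (3 * k * k) ℤ.+ + k) ℤ.+ s (+ m ℤ.- + (3 * k * k) ℤ.- + k))

sumℤ : List ℤ → ℤ
sumℤ [] = + 0
sumℤ (x ∷ xs) = x ℤ.+ sumℤ xs

-- E(m) = s(m) + Σ_{k ≥ 1} (-1)^k [s(m - 3k² + k) + s(m - 3k² - k)].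
-- All terms with k > m vanish (3k² - k > m), so the sum is over k = 1 .. m+1.
E : ℕ → ℤ
E m = s (+ m) ℤ.+ sumℤ (applyUpTo (λ i → term m (suc i)) (suc m))

tri : ℕ → ℕ
tri l = Data.Nat._/_ (l * suc l) 2

{-# OPTIONS --safe #-}
module Submission where

-- Since Σ q(n) x^n = ∏_{i ≥ 1} (1 + x^i) and s = (1 − x)² q, E(m) is the coefficient of x^m in
-- (1 − x)² ∏ (1 + x^i) Σ_{k ∈ ℤ} (−1)^k x^(3k² + k).  By Euler's pentagonal theorem in x² the sum is
-- ∏ (1 − x^(2i)), and ∏ (1 − x^(2i)) ∏ (1 + x^i) = Σ_l x^(l(l+1)/2) is Gauss's identity.  Hence
-- E(m) = ψ(m) − 2ψ(m − 1) + ψ(m − 2) with ψ the indicator of the triangular numbers, and the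
-- four cases follow from the gaps T(l + 1) − T(l) = l + 1.
--
-- Both identities are specialisations of Jacobi's triple product, which holds modulo x^n
-- as a consequence of its finite form
--   Σ_{|k| ≤ n} z^k q^(k(k−1)/2) [2n, n + k]_q = ∏_{i < n} (1 + z q^i) (1 + z⁻¹ q^(i+1)),
-- proved by induction on n from the q-Pascal recurrences.  Power series are integer
-- sequences, and multiplication by a fixed series is handled as a linear operator.

open import Defs
open import Data.Nat using (ℕ; zero; suc; _+_; _*_; _∸_; _/_; _≤_; _<_; _≥_; z≤n; s≤s; _≤ᵇ_)
open import Data.Nat.DivMod using (m*n/n≡m)
import Data.Nat.Properties as ℕₚ
import Data.Nat.Tactic.RingSolver as ℕ-Solver
open import Data.Integer as ℤ using (ℤ; +_; -_; 0ℤ; 1ℤ; -1ℤ)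
import Data.Integer.Properties as ℤₚ
import Data.Integer.Tactic.RingSolver as ℤ-Solver
open import Data.Product using (_×_; _,_; ∃-syntax)
open import Data.Sum using (_⊎_; inj₁; inj₂)
open import Data.Bool using (true; false; if_then_else_)
open import Data.List using (List; []; _∷_; _++_; length; map; applyUpTo)
import Data.List.Properties as Listₚ
open import Relation.Binary.PropositionalEquality
open import Relation.Nullary using (¬_; contradiction; yes; no)
open import Function using (_∘_)
open import Level using (0ℓ)
open import Relation.Binary.Bundles using (Setoid)
import Relation.Binary.Reasoning.Setoid as SetoidReasoning

Series : Set
Series = ℕ → ℤ

infix 4 _≈_ _≈[_]_
infixl 6 _⊕_
infixl 7 _⊛_

_≈_ : Series → Series → Set
f ≈ g = ∀ n → f n ≡ g n

_≈[_]_ : Series → ℕ → Series → Set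
f ≈[ L ] g = ∀ n → n < L → f n ≡ g n

0ₛ 1ₛ : Series
0ₛ _ = 0ℤ
1ₛ zero = 1ℤ
1ₛ (suc _) = 0ℤ

_⊕_ : Series → Series → Series
(f ⊕ g) n = f n ℤ.+ g n

_⊛_ : ℤ → Series → Series
(c ⊛ f) n = c ℤ.* f n

shift : ℕ → Series → Series
shift zero f = f
shift (suc k) f zero = 0ℤ
shift (suc k) f (suc n) = shift k f n

factor : ℤ → ℕ → Series → Series
factor c k f = f ⊕ c ⊛ shift k f

≈-refl : ∀ {f} → f ≈ f
≈-refl n = refl

≈-sym : ∀ {f g} → f ≈ g → g ≈ f
≈-sym p n = sym (p n)

≈-trans : ∀ {f g h} → f ≈ g → g ≈ h → f ≈ h
≈-trans p q n = trans (p n) (q n)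

≈[]-refl : ∀ {L f} → f ≈[ L ] f
≈[]-refl n _ = refl

≈[]-sym : ∀ {L f g} → f ≈[ L ] g → g ≈[ L ] f
≈[]-sym p n n<L = sym (p n n<L)

≈[]-trans : ∀ {L f g h} → f ≈[ L ] g → g ≈[ L ] h → f ≈[ L ] h
≈[]-trans p q n n<L = trans (p n n<L) (q n n<L)

≈⇒≈[] : ∀ {L f g} → f ≈ g → f ≈[ L ] g
≈⇒≈[] p n _ = p n

≈[]-mono : ∀ {L M f g} → M ≤ L → f ≈[ L ] g → f ≈[ M ] g
≈[]-mono M≤L p n n<M = p n (ℕₚ.<-≤-trans n<M M≤L)

≈-setoid : Setoid 0ℓ 0ℓ
≈-setoid = record
  { Carrier = Series ; _≈_ = _≈_
  ; isEquivalence = record { refl = ≈-refl ; sym = ≈-sym ; trans = ≈-trans } }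

≈[]-setoid : ℕ → Setoid 0ℓ 0ℓ
≈[]-setoid L = record
  { Carrier = Series ; _≈_ = _≈[ L ]_
  ; isEquivalence = record { refl = ≈[]-refl ; sym = ≈[]-sym ; trans = ≈[]-trans } }

module ≈-Reasoning = SetoidReasoning ≈-setoid
module ≈[]-Reasoning (L : ℕ) = SetoidReasoning (≈[]-setoid L)

⊕-cong : ∀ {f f′ g g′} → f ≈ f′ → g ≈ g′ → f ⊕ g ≈ f′ ⊕ g′
⊕-cong p q n = cong₂ ℤ._+_ (p n) (q n)

⊕-cong[] : ∀ {L f f′ g g′} → f ≈[ L ] f′ → g ≈[ L ] g′ → f ⊕ g ≈[ L ] f′ ⊕ g′
⊕-cong[] p q n n<L = cong₂ ℤ._+_ (p n n<L) (q n n<L)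

⊛-cong : ∀ c {f f′} → f ≈ f′ → c ⊛ f ≈ c ⊛ f′
⊛-cong c p n = cong (c ℤ.*_) (p n)

⊛-cong[] : ∀ c {L f f′} → f ≈[ L ] f′ → c ⊛ f ≈[ L ] c ⊛ f′
⊛-cong[] c p n n<L = cong (c ℤ.*_) (p n n<L)

shift-cong : ∀ k {f g} → f ≈ g → shift k f ≈ shift k g
shift-cong zero p n = p n
shift-cong (suc k) p zero = refl
shift-cong (suc k) p (suc n) = shift-cong k p n

shift-cong[] : ∀ k {L f g} → f ≈[ L ] g → shift k f ≈[ L ] shift k g
shift-cong[] zero p = p
shift-cong[] (suc k) p zero _ = refl
shift-cong[] (suc k) p (suc n) n<L = shift-cong[] k p n (ℕₚ.<-trans (ℕₚ.n<1+n n) n<L)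

shift-cong[+] : ∀ k {L f g} → f ≈[ L ] g → shift k f ≈[ k + L ] shift k g
shift-cong[+] zero p = p
shift-cong[+] (suc k) p zero _ = refl
shift-cong[+] (suc k) p (suc n) (s≤s n<k+L) = shift-cong[+] k p n n<k+L

shift-⊕ : ∀ k f g → shift k (f ⊕ g) ≈ shift k f ⊕ shift k g
shift-⊕ zero f g n = refl
shift-⊕ (suc k) f g zero = refl
shift-⊕ (suc k) f g (suc n) = shift-⊕ k f g n

shift-⊛ : ∀ k c f → shift k (c ⊛ f) ≈ c ⊛ shift k f
shift-⊛ zero c f n = refl
shift-⊛ (suc k) c f zero = sym (ℤₚ.*-zeroʳ c)
shift-⊛ (suc k) c f (suc n) = shift-⊛ k c f n

shift-0ₛ : ∀ k → shift k 0ₛ ≈ 0ₛ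
shift-0ₛ zero n = refl
shift-0ₛ (suc k) zero = refl
shift-0ₛ (suc k) (suc n) = shift-0ₛ k n

shift-+ : ∀ j k f → shift j (shift k f) ≈ shift (j + k) f
shift-+ zero k f n = refl
shift-+ (suc j) k f zero = refl
shift-+ (suc j) k f (suc n) = shift-+ j k f n

shift-comm : ∀ j k f → shift j (shift k f) ≈ shift k (shift j f)
shift-comm j k f n = begin
  shift j (shift k f) n  ≡⟨ shift-+ j k f n ⟩
  shift (j + k) f n      ≡⟨ cong (λ i → shift i f n) (ℕₚ.+-comm j k) ⟩
  shift (k + j) f n      ≡⟨ shift-+ k j f n ⟨
  shift k (shift j f) n  ∎
  where open ≡-Reasoning

shift-below : ∀ k f n → n < k → shift k f n ≡ 0ℤ
shift-below (suc k) f zero _ = refl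
shift-below (suc k) f (suc n) (s≤s n<k) = shift-below k f n n<k

shift-of-≈0ₛ : ∀ k {f} → f ≈ 0ₛ → shift k f ≈ 0ₛ
shift-of-≈0ₛ k p = ≈-trans (shift-cong k p) (shift-0ₛ k)

shift-≈[]-0ₛ : ∀ k {L} f → L ≤ k → shift k f ≈[ L ] 0ₛ
shift-≈[]-0ₛ k f L≤k n n<L = shift-below k f n (ℕₚ.<-≤-trans n<L L≤k)

shift-1ₛ-at : ∀ k → shift k 1ₛ k ≡ 1ℤ
shift-1ₛ-at zero = refl
shift-1ₛ-at (suc k) = shift-1ₛ-at k

shift-1ₛ-off : ∀ k n → k ≢ n → shift k 1ₛ n ≡ 0ℤ
shift-1ₛ-off zero zero k≢n = contradiction refl k≢n
shift-1ₛ-off zero (suc n) _ = refl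
shift-1ₛ-off (suc k) zero _ = refl
shift-1ₛ-off (suc k) (suc n) k≢n = shift-1ₛ-off k n (k≢n ∘ cong suc)

-- Multiplication by a fixed series, as an operator: additive, homogeneous, commuting
-- with x, and causal (the first field).
record IsLinear (O : Series → Series) : Set where
  field
    preserves-≈[] : ∀ {L f g} → f ≈[ L ] g → O f ≈[ L ] O g
    ⊕-hom : ∀ f g → O (f ⊕ g) ≈ O f ⊕ O g
    ⊛-hom : ∀ c f → O (c ⊛ f) ≈ c ⊛ O f
    shift-hom : ∀ k f → O (shift k f) ≈ shift k (O f)

  preserves-≈ : ∀ {f g} → f ≈ g → O f ≈ O g
  preserves-≈ p n = preserves-≈[] (≈⇒≈[] p) n (ℕₚ.n<1+n n)

  0ₛ-hom : O 0ₛ ≈ 0ₛ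
  0ₛ-hom n = begin
    O 0ₛ n            ≡⟨ preserves-≈ (λ _ → sym (ℤₚ.*-zeroˡ 0ℤ)) n ⟩
    O (0ℤ ⊛ 0ₛ) n     ≡⟨ ⊛-hom 0ℤ 0ₛ n ⟩
    0ℤ ℤ.* O 0ₛ n     ≡⟨ ℤₚ.*-zeroˡ (O 0ₛ n) ⟩
    0ℤ                ∎
    where open ≡-Reasoning

open IsLinear public

id-isLinear : IsLinear (λ f → f)
id-isLinear = record
  { preserves-≈[] = λ p → p
  ; ⊕-hom = λ _ _ → ≈-refl
  ; ⊛-hom = λ _ _ → ≈-refl
  ; shift-hom = λ _ _ → ≈-refl
  }

∘-isLinear : ∀ {O O′} → IsLinear O → IsLinear O′ → IsLinear (λ f → O (O′ f))
∘-isLinear {O} {O′} A B = record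
  { preserves-≈[] = preserves-≈[] A ∘ preserves-≈[] B
  ; ⊕-hom = λ f g → ≈-trans (preserves-≈ A (⊕-hom B f g)) (⊕-hom A (O′ f) (O′ g))
  ; ⊛-hom = λ c f → ≈-trans (preserves-≈ A (⊛-hom B c f)) (⊛-hom A c (O′ f))
  ; shift-hom = λ k f → ≈-trans (preserves-≈ A (shift-hom B k f)) (shift-hom A k (O′ f))
  }

⊕-isLinear : ∀ {O O′} → IsLinear O → IsLinear O′ → IsLinear (λ f → O f ⊕ O′ f)
⊕-isLinear {O} {O′} A B = record
  { preserves-≈[] = λ p → ⊕-cong[] (preserves-≈[] A p) (preserves-≈[] B p)
  ; ⊕-hom = λ f g n → trans (cong₂ ℤ._+_ (⊕-hom A f g n) (⊕-hom B f g n))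
                             (+-interchange (O f n) (O g n) (O′ f n) (O′ g n))
  ; ⊛-hom = λ c f n → trans (cong₂ ℤ._+_ (⊛-hom A c f n) (⊛-hom B c f n))
                             (sym (ℤₚ.*-distribˡ-+ c (O f n) (O′ f n)))
  ; shift-hom = λ k f n → trans (cong₂ ℤ._+_ (shift-hom A k f n) (shift-hom B k f n))
                                 (sym (shift-⊕ k (O f) (O′ f) n))
  }
  where
  +-interchange : ∀ w x y z → (w ℤ.+ x) ℤ.+ (y ℤ.+ z) ≡ (w ℤ.+ y) ℤ.+ (x ℤ.+ z)
  +-interchange = ℤ-Solver.solve-∀

shift-isLinear : ∀ k → IsLinear (shift k)
shift-isLinear k = record
  { preserves-≈[] = shift-cong[] k
  ; ⊕-hom = shift-⊕ k
  ; ⊛-hom = shift-⊛ k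
  ; shift-hom = λ j f → shift-comm k j f
  }

⊛-isLinear : ∀ c → IsLinear (c ⊛_)
⊛-isLinear c = record
  { preserves-≈[] = ⊛-cong[] c
  ; ⊕-hom = λ f g n → ℤₚ.*-distribˡ-+ c (f n) (g n)
  ; ⊛-hom = λ d f n → *-left-comm c d (f n)
  ; shift-hom = λ k f n → sym (shift-⊛ k c f n)
  }
  where
  *-left-comm : ∀ x y z → x ℤ.* (y ℤ.* z) ≡ y ℤ.* (x ℤ.* z)
  *-left-comm = ℤ-Solver.solve-∀

factor-isLinear : ∀ c k → IsLinear (factor c k)
factor-isLinear c k = ⊕-isLinear id-isLinear (∘-isLinear (⊛-isLinear c) (shift-isLinear k))

factor-comm : ∀ c k {O} → IsLinear O → ∀ f → factor c k (O f) ≈ O (factor c k f)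
factor-comm c k {O} A f = ≈-sym (≈-trans (⊕-hom A f (c ⊛ shift k f))
  (⊕-cong (≈-refl {O f}) (≈-trans (⊛-hom A c (shift k f)) (⊛-cong c (shift-hom A k f)))))

factor-≡ : ∀ c {k k′} → k ≡ k′ → ∀ f → factor c k f ≈ factor c k′ f
factor-≡ c refl f = ≈-refl

-- Products of factors commute with every linear operator; this stands in for
-- commutativity of the product of power series.
record IsMultiplier (O : Series → Series) : Set₁ where
  field
    isLinear : IsLinear O
    commutes : ∀ {O′} → IsLinear O′ → ∀ f → O (O′ f) ≈ O′ (O f)

open IsMultiplier public

factor-isMultiplier : ∀ c k → IsMultiplier (factor c k)
factor-isMultiplier c k = record { isLinear = factor-isLinear c k ; commutes = factor-comm c k }

id-isMultiplier : IsMultiplier (λ f → f)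
id-isMultiplier = record { isLinear = id-isLinear ; commutes = λ _ _ → ≈-refl }

∘-isMultiplier : ∀ {O O′} → IsMultiplier O → IsMultiplier O′ → IsMultiplier (λ f → O (O′ f))
∘-isMultiplier {O} {O′} A B = record
  { isLinear = ∘-isLinear (isLinear A) (isLinear B)
  ; commutes = λ C f → ≈-trans (preserves-≈ (isLinear A) (commutes B C f)) (commutes A C (O′ f))
  }

∏ : ℕ → (ℕ → Series → Series) → Series → Series
∏ zero g f = f
∏ (suc n) g f = g n (∏ n g f)

∏-isMultiplier : ∀ n g → (∀ i → IsMultiplier (g i)) → IsMultiplier (∏ n g)
∏-isMultiplier zero g G = id-isMultiplier
∏-isMultiplier (suc n) g G = ∘-isMultiplier (G n) (∏-isMultiplier n g G)

∏-cong : ∀ n {g h} → (∀ i f → g i f ≈ h i f) → (∀ i → IsLinear (h i)) → ∀ f → ∏ n g f ≈ ∏ n h f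
∏-cong zero p H f = ≈-refl
∏-cong (suc n) {g} p H f = ≈-trans (p n (∏ n g f)) (preserves-≈ (H n) (∏-cong n p H f))

IsIdentityMod : ℕ → (Series → Series) → Set
IsIdentityMod L O = ∀ f → O f ≈[ L ] f

factor-isIdentityMod : ∀ c k {L} → L ≤ k → IsIdentityMod L (factor c k)
factor-isIdentityMod c k L≤k f n n<L = begin
  f n ℤ.+ c ℤ.* shift k f n  ≡⟨ cong (λ t → f n ℤ.+ c ℤ.* t) (shift-≈[]-0ₛ k f L≤k n n<L) ⟩
  f n ℤ.+ c ℤ.* 0ℤ           ≡⟨ cong (λ t → f n ℤ.+ t) (ℤₚ.*-zeroʳ c) ⟩
  f n ℤ.+ 0ℤ                 ≡⟨ ℤₚ.+-identityʳ (f n) ⟩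
  f n                        ∎
  where open ≡-Reasoning

∏-stable : ∀ L n g → (∀ i → n ≤ i → IsIdentityMod L (g i)) → ∀ m → n ≤ m → ∀ f → ∏ m g f ≈[ L ] ∏ n g f
∏-stable L n g I m n≤m f with ℕₚ.m≤n⇒m<n∨m≡n n≤m
... | inj₂ refl = ≈[]-refl
∏-stable L n g I (suc m) _ f | inj₁ (s≤s n≤m) =
  ≈[]-trans (I m n≤m (∏ m g f)) (∏-stable L n g I m n≤m f)

∑ : ℕ → (ℕ → Series) → Series
∑ zero F = 0ₛ
∑ (suc R) F = F 0 ⊕ ∑ R (F ∘ suc)

∑-cong : ∀ R {F G} → (∀ j → F j ≈ G j) → ∑ R F ≈ ∑ R G
∑-cong zero p n = refl
∑-cong (suc R) p n = cong₂ ℤ._+_ (p 0 n) (∑-cong R (p ∘ suc) n)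

∑-cong[] : ∀ R {L F G} → (∀ j → j < R → F j ≈[ L ] G j) → ∑ R F ≈[ L ] ∑ R G
∑-cong[] zero p n _ = refl
∑-cong[] (suc R) p n n<L = cong₂ ℤ._+_ (p 0 (s≤s z≤n) n n<L) (∑-cong[] R (λ j j<R → p (suc j) (s≤s j<R)) n n<L)

∑-⊕ : ∀ R F G → ∑ R (λ j → F j ⊕ G j) ≈ ∑ R F ⊕ ∑ R G
∑-⊕ zero F G n = refl
∑-⊕ (suc R) F G n = trans (cong (λ t → F 0 n ℤ.+ G 0 n ℤ.+ t) (∑-⊕ R (F ∘ suc) (G ∘ suc) n))
  (+-interchange (F 0 n) (G 0 n) (∑ R (F ∘ suc) n) (∑ R (G ∘ suc) n))
  where
  +-interchange : ∀ w x y z → (w ℤ.+ x) ℤ.+ (y ℤ.+ z) ≡ (w ℤ.+ y) ℤ.+ (x ℤ.+ z)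
  +-interchange = ℤ-Solver.solve-∀

∑-suc : ∀ R F → ∑ (suc R) F ≈ ∑ R F ⊕ F R
∑-suc zero F n = trans (ℤₚ.+-identityʳ (F 0 n)) (sym (ℤₚ.+-identityˡ (F 0 n)))
∑-suc (suc R) F n = trans (cong (λ t → F 0 n ℤ.+ t) (∑-suc R (F ∘ suc) n)) (sym (ℤₚ.+-assoc (F 0 n) _ _))

∑-extend : ∀ R F → (∀ j → R ≤ j → F j ≈ 0ₛ) → ∀ m → ∑ (m + R) F ≈ ∑ R F
∑-extend R F vanish zero = ≈-refl
∑-extend R F vanish (suc m) n = begin
  ∑ (suc (m + R)) F n           ≡⟨ ∑-suc (m + R) F n ⟩
  ∑ (m + R) F n ℤ.+ F (m + R) n ≡⟨ cong₂ ℤ._+_ (∑-extend R F vanish m n) (vanish (m + R) (ℕₚ.m≤n+m R m) n) ⟩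
  ∑ R F n ℤ.+ 0ℤ                ≡⟨ ℤₚ.+-identityʳ _ ⟩
  ∑ R F n                       ∎
  where open ≡-Reasoning

linear-∑ : ∀ {O} → IsLinear O → ∀ R F → O (∑ R F) ≈ ∑ R (O ∘ F)
linear-∑ A zero F = 0ₛ-hom A
linear-∑ {O} A (suc R) F = ≈-trans (⊕-hom A (F 0) _) (⊕-cong (≈-refl {O (F 0)}) (linear-∑ A R (F ∘ suc)))

∑-isLinear : ∀ R (O : ℕ → Series → Series) → (∀ i → IsLinear (O i)) → IsLinear (λ f → ∑ R (λ i → O i f))
∑-isLinear zero O A = record
  { preserves-≈[] = λ _ → ≈[]-refl
  ; ⊕-hom = λ _ _ n → refl
  ; ⊛-hom = λ c _ n → sym (ℤₚ.*-zeroʳ c)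
  ; shift-hom = λ k _ n → sym (shift-0ₛ k n)
  }
∑-isLinear (suc R) O A = ⊕-isLinear (A 0) (∑-isLinear R (O ∘ suc) (A ∘ suc))

monomial : ℤ → ℕ → Series → Series
monomial c k f = c ⊛ shift k f

monomial-isLinear : ∀ c k → IsLinear (monomial c k)
monomial-isLinear c k = ∘-isLinear (⊛-isLinear c) (shift-isLinear k)

monomial-≡ : ∀ {c c′ k k′ f f′} → c ≡ c′ → k ≡ k′ → f ≈ f′ → monomial c k f ≈ monomial c′ k′ f′
monomial-≡ {c} {k = k} refl refl = preserves-≈ (monomial-isLinear c k)

monomial-cong[+] : ∀ c k {L f g} → f ≈[ L ] g → monomial c k f ≈[ k + L ] monomial c k g
monomial-cong[+] c k p n n<k+L = cong (c ℤ.*_) (shift-cong[+] k p n n<k+L)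

shift-monomial : ∀ j c k f → shift j (monomial c k f) ≈ monomial c (j + k) f
shift-monomial j c k f n = trans (shift-⊛ j c (shift k f) n) (cong (c ℤ.*_) (shift-+ j k f n))

monomial-shift : ∀ c k j f → monomial c k (shift j f) ≈ monomial c (j + k) f
monomial-shift c k j f = ≈-trans (shift-hom (monomial-isLinear c k) j f) (shift-monomial j c k f)

⊛-monomial : ∀ c′ c k f → c′ ⊛ monomial c k f ≈ monomial (c′ ℤ.* c) k f
⊛-monomial c′ c k f n = sym (ℤₚ.*-assoc c′ c (shift k f n))

monomial-monomial : ∀ c k c′ k′ f → monomial c k (monomial c′ k′ f) ≈ monomial (c ℤ.* c′) (k + k′) f
monomial-monomial c k c′ k′ f = ≈-trans (⊛-cong c (shift-monomial k c′ k′ f)) (⊛-monomial c c′ (k + k′) f)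

monomial-of-≈0ₛ : ∀ c k {f} → f ≈ 0ₛ → monomial c k f ≈ 0ₛ
monomial-of-≈0ₛ c k p = ≈-trans (preserves-≈ (monomial-isLinear c k) p) (0ₛ-hom (monomial-isLinear c k))

after : ℕ → (ℕ → Series) → ℕ → Series
after zero F = F
after (suc k) F zero = 0ₛ
after (suc k) F (suc j) = after k F j

∑-after : ∀ k R F → ∑ (k + R) (after k F) ≈ ∑ R F
∑-after zero R F = ≈-refl
∑-after (suc k) R F n = trans (ℤₚ.+-identityˡ _) (∑-after k R F n)

-- Gaussian binomial coefficients in q = x^a.
module Gaussian (a : ℕ) where

  binom : ℕ → ℕ → Series
  binom zero zero = 1ₛ
  binom zero (suc K) = 0ₛ
  binom (suc N) zero = 1ₛ
  binom (suc N) (suc K) = binom N K ⊕ shift (a * suc K) (binom N (suc K))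

  binom-zeroʳ : ∀ N → binom N 0 ≈ 1ₛ
  binom-zeroʳ zero = ≈-refl
  binom-zeroʳ (suc N) = ≈-refl

  binom-above : ∀ {N K} → N < K → binom N K ≈ 0ₛ
  binom-above {zero} {suc K} _ = ≈-refl
  binom-above {suc N} {suc K} (s≤s N<K) n = begin
    binom N K n ℤ.+ shift (a * suc K) (binom N (suc K)) n
      ≡⟨ cong₂ ℤ._+_ (binom-above N<K n) (shift-of-≈0ₛ (a * suc K) (binom-above (ℕₚ.m<n⇒m<1+n N<K)) n) ⟩
    0ℤ                                                       ∎
    where open ≡-Reasoning

  binom-diag : ∀ K → binom K K ≈ 1ₛ
  binom-diag zero = ≈-refl
  binom-diag (suc K) n = begin
    binom K K n ℤ.+ shift (a * suc K) (binom K (suc K)) n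
      ≡⟨ cong₂ ℤ._+_ (binom-diag K n) (shift-of-≈0ₛ (a * suc K) (binom-above (ℕₚ.n<1+n K)) n) ⟩
    1ₛ n ℤ.+ 0ℤ                                              ≡⟨ ℤₚ.+-identityʳ (1ₛ n) ⟩
    1ₛ n                                                     ∎
    where open ≡-Reasoning

  -- An exponent identity only has to hold where the coefficient is nonzero.
  shift-binom-≡ : ∀ N K {e e′} → (K ≤ N → e ≡ e′) → shift e (binom N K) ≈ shift e′ (binom N K)
  shift-binom-≡ N K {e} {e′} eq with K ℕₚ.≤? N
  ... | yes K≤N = λ n → cong (λ t → shift t (binom N K) n) (eq K≤N)
  ... | no K≰N = ≈-trans (shift-of-≈0ₛ e vanish) (≈-sym (shift-of-≈0ₛ e′ vanish))
    where vanish = binom-above (ℕₚ.≰⇒> K≰N)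

  exponent-sum : ∀ {N K} → K ≤ N → a * suc K + a * (N ∸ K) ≡ a * suc N
  exponent-sum {N} {K} K≤N =
    trans (sym (ℕₚ.*-distribˡ-+ a (suc K) (N ∸ K))) (cong (λ t → a * suc t) (ℕₚ.m+[n∸m]≡n K≤N))

  shift²-binom : ∀ N K j k → (K ≤ N → j + k ≡ a * suc N) →
                 shift j (shift k (binom N K)) ≈ shift (a * suc N) (binom N K)
  shift²-binom N K j k eq = ≈-trans (shift-+ j k (binom N K)) (shift-binom-≡ N K eq)

  exponent-sum′ : ∀ {N K} → K < N → a * (N ∸ K) + a * suc K ≡ a * suc N
  exponent-sum′ {N} {K} K<N = trans (ℕₚ.+-comm (a * (N ∸ K)) (a * suc K)) (exponent-sum (ℕₚ.<⇒≤ K<N))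

  mutual
    binom-suc-dual : ∀ N K → binom (suc N) (suc K) ≈ shift (a * (N ∸ K)) (binom N K) ⊕ binom N (suc K)
    binom-suc-dual zero zero n = begin
      1ₛ n ℤ.+ shift (a * 1) 0ₛ n  ≡⟨ cong (λ t → 1ₛ n ℤ.+ t) (shift-0ₛ (a * 1) n) ⟩
      1ₛ n ℤ.+ 0ℤ                  ≡⟨ cong (λ e → shift e 1ₛ n ℤ.+ 0ℤ) (ℕₚ.*-zeroʳ a) ⟨
      shift (a * 0) 1ₛ n ℤ.+ 0ℤ    ∎
      where open ≡-Reasoning
    binom-suc-dual zero (suc K) n = begin
      0ℤ ℤ.+ shift (a * suc (suc K)) 0ₛ n  ≡⟨ cong (λ t → 0ℤ ℤ.+ t) (shift-0ₛ (a * suc (suc K)) n) ⟩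
      0ℤ                                   ≡⟨ cong (λ t → t ℤ.+ 0ℤ) (shift-0ₛ (a * 0) n) ⟨
      shift (a * 0) 0ₛ n ℤ.+ 0ℤ            ∎
      where open ≡-Reasoning
    binom-suc-dual (suc N) zero n = begin
      binom (suc (suc N)) 1 n
        ≡⟨ binom-suc²-1 N n ⟩
      (binom N 0 n ℤ.+ 1ℤ ℤ.* shift (a * suc N) (binom N 0) n) ℤ.+ t
        ≡⟨ cong (λ u → (binom N 0 n ℤ.+ 1ℤ ℤ.* u) ℤ.+ t) (shift-cong (a * suc N) (binom-zeroʳ N) n) ⟩
      (binom N 0 n ℤ.+ 1ℤ ℤ.* shift (a * suc N) 1ₛ n) ℤ.+ t
        ≡⟨ rearrange (binom N 0 n) (shift (a * suc N) 1ₛ n) t ⟩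
      shift (a * suc N) 1ₛ n ℤ.+ (binom N 0 n ℤ.+ t)
        ∎
      where
      open ≡-Reasoning
      t = shift (a * 1) (binom N 1) n
      rearrange : ∀ x y z → (x ℤ.+ 1ℤ ℤ.* y) ℤ.+ z ≡ y ℤ.+ (x ℤ.+ z)
      rearrange = ℤ-Solver.solve-∀
    binom-suc-dual (suc N) (suc K) n = begin
      binom (suc (suc N)) (suc (suc K)) n
        ≡⟨ binom-suc² N K n ⟩
      (binom N (suc K) n ℤ.+ 1ℤ ℤ.* qY) ℤ.+ sX ℤ.+ sW
        ≡⟨ rearrange (binom N (suc K) n) qY sX sW ⟩
      (sX ℤ.+ qY) ℤ.+ (binom N (suc K) n ℤ.+ sW)
        ≡⟨ cong (λ u → (sX ℤ.+ u) ℤ.+ (binom N (suc K) n ℤ.+ sW))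
                (shift²-binom N (suc K) (a * (N ∸ K)) (a * suc K) exponent-sum′ n) ⟨
      (sX ℤ.+ shift (a * (N ∸ K)) (shift (a * suc K) (binom N (suc K))) n) ℤ.+ (binom N (suc K) n ℤ.+ sW)
        ≡⟨ cong (λ u → u ℤ.+ (binom N (suc K) n ℤ.+ sW)) (shift-⊕ (a * (N ∸ K)) (binom N K) _ n) ⟨
      shift (a * (N ∸ K)) (binom (suc N) (suc K)) n ℤ.+ binom (suc N) (suc (suc K)) n
        ∎
      where
      open ≡-Reasoning
      sX = shift (a * (N ∸ K)) (binom N K) n
      qY = shift (a * suc N) (binom N (suc K)) n
      sW = shift (a * suc (suc K)) (binom N (suc (suc K))) n
      rearrange : ∀ y q x w → (y ℤ.+ 1ℤ ℤ.* q) ℤ.+ x ℤ.+ w ≡ (x ℤ.+ q) ℤ.+ (y ℤ.+ w)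
      rearrange = ℤ-Solver.solve-∀

    binom-suc²-1 : ∀ N → binom (suc (suc N)) 1 ≈ factor 1ℤ (a * suc N) (binom N 0) ⊕ shift (a * 1) (binom N 1)
    binom-suc²-1 N n = begin
      1ₛ n ℤ.+ shift (a * 1) (binom (suc N) 1) n
        ≡⟨ cong (λ u → 1ₛ n ℤ.+ u) (shift-cong (a * 1) (binom-suc-dual N 0) n) ⟩
      1ₛ n ℤ.+ shift (a * 1) (shift (a * N) (binom N 0) ⊕ binom N 1) n
        ≡⟨ cong (λ u → 1ₛ n ℤ.+ u) (shift-⊕ (a * 1) _ (binom N 1) n) ⟩
      1ₛ n ℤ.+ (shift (a * 1) (shift (a * N) (binom N 0)) n ℤ.+ t)
        ≡⟨ cong (λ u → 1ₛ n ℤ.+ (u ℤ.+ t)) (shift²-binom N 0 (a * 1) (a * N) (λ _ → exponent-sum z≤n) n) ⟩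
      1ₛ n ℤ.+ (shift (a * suc N) (binom N 0) n ℤ.+ t)
        ≡⟨ rearrange (1ₛ n) (shift (a * suc N) (binom N 0) n) t ⟩
      (1ₛ n ℤ.+ 1ℤ ℤ.* shift (a * suc N) (binom N 0) n) ℤ.+ t
        ≡⟨ cong (λ u → (u ℤ.+ 1ℤ ℤ.* shift (a * suc N) (binom N 0) n) ℤ.+ t) (binom-zeroʳ N n) ⟨
      (binom N 0 n ℤ.+ 1ℤ ℤ.* shift (a * suc N) (binom N 0) n) ℤ.+ t
        ∎
      where
      open ≡-Reasoning
      t = shift (a * 1) (binom N 1) n
      rearrange : ∀ x y z → x ℤ.+ (y ℤ.+ z) ≡ (x ℤ.+ 1ℤ ℤ.* y) ℤ.+ z
      rearrange = ℤ-Solver.solve-∀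

    binom-suc² : ∀ N K → binom (suc (suc N)) (suc (suc K)) ≈
      factor 1ℤ (a * suc N) (binom N (suc K)) ⊕ shift (a * (N ∸ K)) (binom N K) ⊕ shift (a * suc (suc K)) (binom N (suc (suc K)))
    binom-suc² N K n = begin
      binom (suc N) (suc K) n ℤ.+ shift (a * suc (suc K)) (binom (suc N) (suc (suc K))) n
        ≡⟨ cong₂ ℤ._+_ (binom-suc-dual N K n) (shift-cong (a * suc (suc K)) (binom-suc-dual N (suc K)) n) ⟩
      (sX ℤ.+ Y n) ℤ.+ shift (a * suc (suc K)) (shift (a * (N ∸ suc K)) Y ⊕ binom N (suc (suc K))) n
        ≡⟨ cong (λ u → (sX ℤ.+ Y n) ℤ.+ u) (shift-⊕ (a * suc (suc K)) _ (binom N (suc (suc K))) n) ⟩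
      (sX ℤ.+ Y n) ℤ.+ (shift (a * suc (suc K)) (shift (a * (N ∸ suc K)) Y) n ℤ.+ sW)
        ≡⟨ cong (λ u → (sX ℤ.+ Y n) ℤ.+ (u ℤ.+ sW)) (shift²-binom N (suc K) (a * suc (suc K)) (a * (N ∸ suc K)) exponent-sum n) ⟩
      (sX ℤ.+ Y n) ℤ.+ (shift (a * suc N) Y n ℤ.+ sW)
        ≡⟨ rearrange sX (Y n) (shift (a * suc N) Y n) sW ⟩
      (Y n ℤ.+ 1ℤ ℤ.* shift (a * suc N) Y n) ℤ.+ sX ℤ.+ sW
        ∎
      where
      open ≡-Reasoning
      Y = binom N (suc K)
      sX = shift (a * (N ∸ K)) (binom N K) n
      sW = shift (a * suc (suc K)) (binom N (suc (suc K))) n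
      rearrange : ∀ x y q w → (x ℤ.+ y) ℤ.+ (q ℤ.+ w) ≡ (y ℤ.+ 1ℤ ℤ.* q) ℤ.+ x ℤ.+ w
      rearrange = ℤ-Solver.solve-∀

  binom-absorb : ∀ N K → factor -1ℤ (a * suc K) (binom (suc N) (suc K)) ≈ factor -1ℤ (a * suc N) (binom N K)
  binom-absorb N K n = begin
    (binom N K n ℤ.+ sY) ℤ.+ -1ℤ ℤ.* shift (a * suc K) (binom (suc N) (suc K)) n
      ≡⟨ cong (λ u → (binom N K n ℤ.+ sY) ℤ.+ -1ℤ ℤ.* u) shifted ⟩
    (binom N K n ℤ.+ sY) ℤ.+ -1ℤ ℤ.* (qX ℤ.+ sY)
      ≡⟨ cancel (binom N K n) sY qX ⟩
    binom N K n ℤ.+ -1ℤ ℤ.* qX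
      ∎
    where
    open ≡-Reasoning
    sY = shift (a * suc K) (binom N (suc K)) n
    qX = shift (a * suc N) (binom N K) n
    shifted : shift (a * suc K) (binom (suc N) (suc K)) n ≡ qX ℤ.+ sY
    shifted = trans (shift-cong (a * suc K) (binom-suc-dual N K) n)
      (trans (shift-⊕ (a * suc K) _ (binom N (suc K)) n)
             (cong (λ u → u ℤ.+ sY) (shift²-binom N K (a * suc K) (a * (N ∸ K)) exponent-sum n)))
    cancel : ∀ x s t → (x ℤ.+ s) ℤ.+ -1ℤ ℤ.* (t ℤ.+ s) ≡ x ℤ.+ -1ℤ ℤ.* t
    cancel = ℤ-Solver.solve-∀

  binom-absorb′ : ∀ N K → factor -1ℤ (a * (N ∸ K)) (binom (suc N) (suc K)) ≈ factor -1ℤ (a * suc N) (binom N (suc K))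
  binom-absorb′ N K n = begin
    binom (suc N) (suc K) n ℤ.+ -1ℤ ℤ.* shift (a * (N ∸ K)) (binom (suc N) (suc K)) n
      ≡⟨ cong₂ (λ u v → u ℤ.+ -1ℤ ℤ.* v) (binom-suc-dual N K n) shifted ⟩
    (sX ℤ.+ binom N (suc K) n) ℤ.+ -1ℤ ℤ.* (sX ℤ.+ qY)
      ≡⟨ cancel sX (binom N (suc K) n) qY ⟩
    binom N (suc K) n ℤ.+ -1ℤ ℤ.* qY
      ∎
    where
    open ≡-Reasoning
    sX = shift (a * (N ∸ K)) (binom N K) n
    qY = shift (a * suc N) (binom N (suc K)) n
    shifted : shift (a * (N ∸ K)) (binom (suc N) (suc K)) n ≡ sX ℤ.+ qY
    shifted = trans (shift-⊕ (a * (N ∸ K)) (binom N K) _ n)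
      (cong (λ u → sX ℤ.+ u) (shift²-binom N (suc K) (a * (N ∸ K)) (a * suc K) exponent-sum′ n))
    cancel : ∀ s y t → (s ℤ.+ y) ℤ.+ -1ℤ ℤ.* (s ℤ.+ t) ≡ y ℤ.+ -1ℤ ℤ.* t
    cancel = ℤ-Solver.solve-∀

  -- poch M K f = (q^(M+1); q)_K · f, so that poch 0 K is multiplication by (q; q)_K.
  poch : ℕ → ℕ → Series → Series
  poch M K = ∏ K (λ i → factor -1ℤ (a * suc (M + i)))

  poch-isMultiplier : ∀ M K → IsMultiplier (poch M K)
  poch-isMultiplier M K = ∏-isMultiplier K _ (λ i → factor-isMultiplier -1ℤ (a * suc (M + i)))

  poch-telescope : ∀ c (B : ℕ → Series) → B 0 ≈ 1ₛ →
    (∀ n → factor -1ℤ (a * suc n) (B (suc n)) ≈ factor -1ℤ (a * suc (c + n)) (B n)) →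
    ∀ n → poch 0 n (B n) ≈ poch c n 1ₛ
  poch-telescope c B B₀ step zero = B₀
  poch-telescope c B B₀ step (suc n) = begin
    factor -1ℤ (a * suc n) (poch 0 n (B (suc n)))    ≈⟨ commutes (factor-isMultiplier -1ℤ (a * suc n)) P (B (suc n)) ⟩
    poch 0 n (factor -1ℤ (a * suc n) (B (suc n)))    ≈⟨ preserves-≈ P (step n) ⟩
    poch 0 n (factor -1ℤ (a * suc (c + n)) (B n))    ≈⟨ commutes (factor-isMultiplier -1ℤ (a * suc (c + n))) P (B n) ⟨
    factor -1ℤ (a * suc (c + n)) (poch 0 n (B n))
      ≈⟨ preserves-≈ (factor-isLinear -1ℤ (a * suc (c + n))) (poch-telescope c B B₀ step n) ⟩
    factor -1ℤ (a * suc (c + n)) (poch c n 1ₛ)       ∎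
    where
    open ≈-Reasoning
    P = isLinear (poch-isMultiplier 0 n)

  qfac-binom : ∀ M K → poch 0 K (binom (K + M) K) ≈ poch M K 1ₛ
  qfac-binom M = poch-telescope M (λ K → binom (K + M) K) (binom-zeroʳ M) step
    where
    step : ∀ n → factor -1ℤ (a * suc n) (binom (suc n + M) (suc n)) ≈ factor -1ℤ (a * suc (M + n)) (binom (n + M) n)
    step n = ≈-trans (binom-absorb (n + M) n) (factor-≡ -1ℤ (cong (λ t → a * suc t) (ℕₚ.+-comm n M)) (binom (n + M) n))

  qfac-binom′ : ∀ K L → poch 0 L (binom (K + L) K) ≈ poch K L 1ₛ
  qfac-binom′ zero L = preserves-≈ (isLinear (poch-isMultiplier 0 L)) (binom-zeroʳ L)
  qfac-binom′ (suc K) = poch-telescope (suc K) (λ L → binom (suc K + L) (suc K)) diag step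
    where
    diag : binom (suc K + 0) (suc K) ≈ 1ₛ
    diag n = trans (cong (λ t → binom t (suc K) n) (ℕₚ.+-identityʳ (suc K))) (binom-diag (suc K) n)
    step : ∀ n → factor -1ℤ (a * suc n) (binom (suc K + suc n) (suc K)) ≈
                 factor -1ℤ (a * suc (suc K + n)) (binom (suc K + n) (suc K))
    step n = begin
      factor -1ℤ (a * suc n) (binom (suc K + suc n) (suc K))
        ≈⟨ factor-≡ -1ℤ (cong (a *_) (ℕₚ.m+n∸m≡n K (suc n))) (binom (suc K + suc n) (suc K)) ⟨
      factor -1ℤ (a * ((K + suc n) ∸ K)) (binom (suc K + suc n) (suc K))
        ≈⟨ binom-absorb′ (K + suc n) K ⟩
      factor -1ℤ (a * suc (K + suc n)) (binom (K + suc n) (suc K))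
        ≈⟨ (λ m → cong (λ t → factor -1ℤ (a * suc t) (binom t (suc K)) m) (ℕₚ.+-suc K n)) ⟩
      factor -1ℤ (a * suc (suc K + n)) (binom (suc K + n) (suc K))
        ∎
      where open ≈-Reasoning

  poch-≈[] : ∀ M K f → poch M K f ≈[ a * suc M ] f
  poch-≈[] M K f = ∏-stable (a * suc M) 0 _ highFactor K z≤n f
    where
    highFactor : ∀ i → 0 ≤ i → IsIdentityMod (a * suc M) (factor -1ℤ (a * suc (M + i)))
    highFactor i _ = factor-isIdentityMod -1ℤ (a * suc (M + i)) (ℕₚ.*-monoʳ-≤ a (s≤s (ℕₚ.m≤m+n M i)))

  qfac-≈[]-1ₛ : ∀ {n j c B} → j ≤ n → j ≤ c → poch 0 j B ≈ poch c j 1ₛ → poch 0 n B ≈[ a * suc j ] 1ₛ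
  qfac-≈[]-1ₛ {n} {j} {c} {B} j≤n j≤c eq = begin
    poch 0 n B   ≈⟨ ∏-stable (a * suc j) j _ highFactor n j≤n B ⟩
    poch 0 j B   ≈⟨ ≈⇒≈[] eq ⟩
    poch c j 1ₛ  ≈⟨ ≈[]-mono (ℕₚ.*-monoʳ-≤ a (s≤s j≤c)) (poch-≈[] c j 1ₛ) ⟩
    1ₛ           ∎
    where
    open ≈[]-Reasoning (a * suc j)
    highFactor : ∀ i → j ≤ i → IsIdentityMod (a * suc j) (factor -1ℤ (a * suc i))
    highFactor i j≤i = factor-isIdentityMod -1ℤ (a * suc i) (ℕₚ.*-monoʳ-≤ a (s≤s j≤i))

double : ℕ → ℕ
double zero = zero
double (suc n) = suc (suc (double n))

double≡+ : ∀ n → double n ≡ n + n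
double≡+ zero = refl
double≡+ (suc n) = cong suc (trans (cong suc (double≡+ n)) (sym (ℕₚ.+-suc n n)))

-- Jacobi's triple product with q = x^(b + d) and z = ε x^d, where ε² = 1.
module TripleProduct (b d : ℕ) (ε : ℤ) (ε²≡1 : ε ℤ.* ε ≡ 1ℤ) where

  a : ℕ
  a = b + d

  open Gaussian a public

  τ⁺ τ⁻ : ℕ → ℕ
  τ⁺ zero = 0
  τ⁺ (suc k) = τ⁺ k + a * k + d
  τ⁻ zero = 0
  τ⁻ (suc k) = τ⁻ k + a * k + b

  ε^ : ℕ → ℤ
  ε^ zero = 1ℤ
  ε^ (suc k) = ε ℤ.* ε^ k

  ε*ε* : ∀ x → ε ℤ.* (ε ℤ.* x) ≡ x
  ε*ε* x = trans (sym (ℤₚ.*-assoc ε ε x)) (trans (cong (ℤ._* x) ε²≡1) (ℤₚ.*-identityˡ x))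

  -- τ n j = τ^±(|j − n|) and σ n j = ε^|j − n| (with + for j ≥ n), written by recursion
  -- to avoid truncated subtraction.
  τ : ℕ → ℕ → ℕ
  τ zero j = τ⁺ j
  τ (suc n) zero = τ⁻ (suc n)
  τ (suc n) (suc j) = τ n j

  σ : ℕ → ℕ → ℤ
  σ zero j = ε^ j
  σ (suc n) zero = ε^ (suc n)
  σ (suc n) (suc j) = σ n j

  τ-zeroʳ : ∀ n → τ n 0 ≡ τ⁻ n
  τ-zeroʳ zero = refl
  τ-zeroʳ (suc n) = refl

  σ-zeroʳ : ∀ n → σ n 0 ≡ ε^ n
  σ-zeroʳ zero = refl
  σ-zeroʳ (suc n) = refl

  τ-below : ∀ n j → j ≤ n → τ n j ≡ τ⁻ (n ∸ j)
  τ-below n zero _ = τ-zeroʳ n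
  τ-below (suc n) (suc j) (s≤s j≤n) = τ-below n j j≤n

  τ-above : ∀ n j → n ≤ j → τ n j ≡ τ⁺ (j ∸ n)
  τ-above zero j _ = refl
  τ-above (suc n) (suc j) (s≤s n≤j) = τ-above n j n≤j

  σ-above : ∀ n j → n ≤ j → σ n j ≡ ε^ (j ∸ n)
  σ-above zero j _ = refl
  σ-above (suc n) (suc j) (s≤s n≤j) = σ-above n j n≤j

  σ-suc : ∀ n j → σ n (suc j) ≡ ε ℤ.* σ n j
  σ-suc zero j = refl
  σ-suc (suc n) zero = trans (σ-zeroʳ n) (sym (ε*ε* (ε^ n)))
  σ-suc (suc n) (suc j) = σ-suc n j

  τ-suc : ∀ n j → τ n (suc j) + a * n ≡ τ n j + a * j + d
  τ-suc zero j = trans (cong (λ t → τ⁺ (suc j) + t) (ℕₚ.*-zeroʳ a)) (ℕₚ.+-identityʳ _)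
  τ-suc (suc n) zero = trans (cong (λ t → t + a * suc n) (τ-zeroʳ n)) (lemma b d (τ⁻ n) n)
    where
    lemma : ∀ b d t n → t + (b + d) * suc n ≡ t + (b + d) * n + b + (b + d) * 0 + d
    lemma = ℕ-Solver.solve-∀
  τ-suc (suc n) (suc j) = trans (lemma b d (τ n (suc j)) n) (trans (cong (λ t → t + a) (τ-suc n j)) (lemma′ b d (τ n j) j))
    where
    lemma : ∀ b d x n → x + (b + d) * suc n ≡ x + (b + d) * n + (b + d)
    lemma = ℕ-Solver.solve-∀
    lemma′ : ∀ b d x j → x + (b + d) * j + d + (b + d) ≡ x + (b + d) * suc j + d
    lemma′ = ℕ-Solver.solve-∀

  c⁺ c⁻ : ℕ → ℕ
  c⁺ i = a * i + d
  c⁻ i = a * i + b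

  τ-suc′ : ∀ n j → a * suc j + τ n j ≡ c⁻ n + τ n (suc j)
  τ-suc′ zero j = lemma b d (τ⁺ j) j
    where
    lemma : ∀ b d t j → (b + d) * suc j + t ≡ (b + d) * 0 + b + (t + (b + d) * j + d)
    lemma = ℕ-Solver.solve-∀
  τ-suc′ (suc n) zero = trans (cong (λ t → a * 1 + (t + a * n + b)) (sym (τ-zeroʳ n))) (lemma b d (τ n 0) n)
    where
    lemma : ∀ b d t n → (b + d) * 1 + (t + (b + d) * n + b) ≡ (b + d) * suc n + b + t
    lemma = ℕ-Solver.solve-∀
  τ-suc′ (suc n) (suc j) = trans (lemma b d (τ n j) j) (trans (cong (λ t → t + a) (τ-suc′ n j)) (lemma′ b d (τ n (suc j)) n))
    where
    lemma : ∀ b d x j → (b + d) * suc (suc j) + x ≡ (b + d) * suc j + x + (b + d)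
    lemma = ℕ-Solver.solve-∀
    lemma′ : ∀ b d x n → (b + d) * n + b + x + (b + d) ≡ (b + d) * suc n + b + x
    lemma′ = ℕ-Solver.solve-∀

  τ-suc-double : ∀ n j → j ≤ double n → a * (double n ∸ j) + τ n (suc j) ≡ c⁺ n + τ n j
  τ-suc-double n j j≤N = ℕₚ.+-cancelˡ-≡ (a * n) _ _ (begin
    a * n + (a * (double n ∸ j) + τ n (suc j))  ≡⟨ lemma₁ (a * n) (a * (double n ∸ j)) (τ n (suc j)) ⟩
    a * (double n ∸ j) + (τ n (suc j) + a * n)  ≡⟨ cong (λ t → a * (double n ∸ j) + t) (τ-suc n j) ⟩
    a * (double n ∸ j) + (τ n j + a * j + d)    ≡⟨ lemma₂ b d (double n ∸ j) j (τ n j) ⟩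
    a * (double n ∸ j + j) + d + τ n j          ≡⟨ cong (λ t → a * t + d + τ n j) (trans (ℕₚ.m∸n+n≡m j≤N) (double≡+ n)) ⟩
    a * (n + n) + d + τ n j                     ≡⟨ lemma₃ b d n (τ n j) ⟩
    a * n + (c⁺ n + τ n j)                      ∎)
    where
    open ≡-Reasoning
    lemma₁ : ∀ x y z → x + (y + z) ≡ y + (z + x)
    lemma₁ = ℕ-Solver.solve-∀
    lemma₂ : ∀ b d u j t → (b + d) * u + (t + (b + d) * j + d) ≡ (b + d) * (u + j) + d + t
    lemma₂ = ℕ-Solver.solve-∀
    lemma₃ : ∀ b d n t → (b + d) * (n + n) + d + t ≡ (b + d) * n + ((b + d) * n + d + t)
    lemma₃ = ℕ-Solver.solve-∀

  jtp-term : ℕ → ℕ → Series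
  jtp-term n j = monomial (σ n j) (τ n j) (binom (double n) j)

  jtp-term-above : ∀ n j → double n < j → jtp-term n j ≈ 0ₛ
  jtp-term-above n j N<j = monomial-of-≈0ₛ (σ n j) (τ n j) (binom-above N<j)

  jtp-factor : ℕ → Series → Series
  jtp-factor i f = factor ε (c⁺ i) (factor ε (c⁻ i) f)

  jtp-product : ℕ → Series → Series
  jtp-product n = ∏ n jtp-factor

  jtp-factor-isMultiplier : ∀ i → IsMultiplier (jtp-factor i)
  jtp-factor-isMultiplier i = ∘-isMultiplier (factor-isMultiplier ε (c⁺ i)) (factor-isMultiplier ε (c⁻ i))


  monomial-binom-as-term : ∀ n j e {c k} → c ≡ ε ℤ.* σ n j → (j ≤ double n → k ≡ e + τ n j) →
                           monomial c k (binom (double n) j) ≈ monomial ε e (jtp-term n j)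
  monomial-binom-as-term n j e {c} {k} c≡ k≡ = begin
    monomial c k (binom (double n) j)                      ≈⟨ ⊛-cong c (shift-binom-≡ (double n) j k≡) ⟩
    monomial c (e + τ n j) (binom (double n) j)            ≈⟨ monomial-≡ {k = e + τ n j} c≡ refl (≈-refl {binom (double n) j}) ⟩
    monomial (ε ℤ.* σ n j) (e + τ n j) (binom (double n) j) ≈⟨ monomial-monomial ε e (σ n j) (τ n j) _ ⟨
    monomial ε e (jtp-term n j)                            ∎
    where open ≈-Reasoning

  σ-suc′ : ∀ n j → σ n j ≡ ε ℤ.* σ n (suc j)
  σ-suc′ n j = trans (sym (ε*ε* (σ n j))) (cong (ε ℤ.*_) (sym (σ-suc n j)))

  jtp-term-suc : ∀ n j → jtp-term (suc n) j ≈
      after 1 (factor 1ℤ (a * suc (double n)) ∘ jtp-term n) j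
    ⊕ after 2 (monomial ε (c⁺ n) ∘ jtp-term n) j
    ⊕ monomial ε (c⁻ n) (jtp-term n j)
  jtp-term-suc n zero m = sym (begin
    0ℤ ℤ.+ monomial ε (c⁻ n) (jtp-term n 0) m
      ≡⟨ ℤₚ.+-identityˡ _ ⟩
    monomial ε (c⁻ n) (jtp-term n 0) m
      ≡⟨ monomial-monomial ε (c⁻ n) (σ n 0) (τ n 0) (binom (double n) 0) m ⟩
    monomial (ε ℤ.* σ n 0) (c⁻ n + τ n 0) (binom (double n) 0) m
      ≡⟨ monomial-≡ (cong (ε ℤ.*_) (σ-zeroʳ n)) exponent (binom-zeroʳ (double n)) m ⟩
    monomial (ε^ (suc n)) (τ⁻ (suc n)) 1ₛ m
      ∎)
    where
    open ≡-Reasoning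
    exponent : c⁻ n + τ n 0 ≡ τ⁻ (suc n)
    exponent = trans (ℕₚ.+-comm (c⁻ n) (τ n 0)) (trans (cong (λ t → t + c⁻ n) (τ-zeroʳ n)) (sym (ℕₚ.+-assoc (τ⁻ n) (a * n) b)))
  jtp-term-suc n (suc zero) = begin
    monomial (σ n 0) (τ n 0) (binom (suc (suc N)) 1)
      ≈⟨ preserves-≈ M (binom-suc²-1 N) ⟩
    monomial (σ n 0) (τ n 0) (factor 1ℤ (a * suc N) (binom N 0) ⊕ shift (a * 1) (binom N 1))
      ≈⟨ ⊕-hom M _ _ ⟩
    monomial (σ n 0) (τ n 0) (factor 1ℤ (a * suc N) (binom N 0)) ⊕ monomial (σ n 0) (τ n 0) (shift (a * 1) (binom N 1))
      ≈⟨ ⊕-cong (≈-sym (factor-comm 1ℤ (a * suc N) M (binom N 0)))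
                (≈-trans (monomial-shift (σ n 0) (τ n 0) (a * 1) (binom N 1))
                         (monomial-binom-as-term n 1 (c⁻ n) (σ-suc′ n 0) (λ _ → τ-suc′ n 0))) ⟩
    factor 1ℤ (a * suc N) (jtp-term n 0) ⊕ monomial ε (c⁻ n) (jtp-term n 1)
      ≈⟨ (λ m → cong (λ t → t ℤ.+ monomial ε (c⁻ n) (jtp-term n 1) m)
                     (sym (ℤₚ.+-identityʳ (factor 1ℤ (a * suc N) (jtp-term n 0) m)))) ⟩
    factor 1ℤ (a * suc N) (jtp-term n 0) ⊕ 0ₛ ⊕ monomial ε (c⁻ n) (jtp-term n 1)
      ∎
    where
    open ≈-Reasoning
    N = double n
    M = monomial-isLinear (σ n 0) (τ n 0)
  jtp-term-suc n (suc (suc j)) = begin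
    monomial sg e (binom (suc (suc N)) (suc (suc j)))
      ≈⟨ preserves-≈ M (binom-suc² N j) ⟩
    monomial sg e (factor 1ℤ (a * suc N) (binom N (suc j)) ⊕ shift (a * (N ∸ j)) (binom N j)
                   ⊕ shift (a * suc (suc j)) (binom N (suc (suc j))))
      ≈⟨ ≈-trans (⊕-hom M _ _) (⊕-cong (⊕-hom M _ _) ≈-refl) ⟩
    monomial sg e (factor 1ℤ (a * suc N) (binom N (suc j)))
      ⊕ monomial sg e (shift (a * (N ∸ j)) (binom N j))
      ⊕ monomial sg e (shift (a * suc (suc j)) (binom N (suc (suc j))))
      ≈⟨ ⊕-cong (⊕-cong (≈-sym (factor-comm 1ℤ (a * suc N) M (binom N (suc j))))
           (≈-trans (monomial-shift sg e (a * (N ∸ j)) (binom N j))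
                    (monomial-binom-as-term n j (c⁺ n) (σ-suc n j) (τ-suc-double n j))))
           (≈-trans (monomial-shift sg e (a * suc (suc j)) (binom N (suc (suc j))))
                    (monomial-binom-as-term n (suc (suc j)) (c⁻ n) (σ-suc′ n (suc j)) (λ _ → τ-suc′ n (suc j)))) ⟩
    factor 1ℤ (a * suc N) (jtp-term n (suc j)) ⊕ monomial ε (c⁺ n) (jtp-term n j) ⊕ monomial ε (c⁻ n) (jtp-term n (suc (suc j)))
      ∎
    where
    open ≈-Reasoning
    N = double n
    sg = σ n (suc j)
    e = τ n (suc j)
    M = monomial-isLinear sg e

  jtp-factor-expand : ∀ n V →
    factor 1ℤ (a * suc (double n)) V ⊕ monomial ε (c⁺ n) V ⊕ monomial ε (c⁻ n) V ≈ jtp-factor n V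
  jtp-factor-expand n V m = begin
    (V m ℤ.+ 1ℤ ℤ.* shift (a * suc (double n)) V m) ℤ.+ ε ℤ.* s⁺ ℤ.+ ε ℤ.* s⁻
      ≡⟨ cong₂ (λ u e → (V m ℤ.+ u ℤ.* shift e V m) ℤ.+ ε ℤ.* s⁺ ℤ.+ ε ℤ.* s⁻) (sym ε²≡1) exponent ⟩
    (V m ℤ.+ (ε ℤ.* ε) ℤ.* X) ℤ.+ ε ℤ.* s⁺ ℤ.+ ε ℤ.* s⁻
      ≡⟨ rearrange ε (V m) X s⁺ s⁻ ⟩
    (V m ℤ.+ ε ℤ.* s⁻) ℤ.+ ε ℤ.* (s⁺ ℤ.+ ε ℤ.* X)
      ≡⟨ cong (λ u → (V m ℤ.+ ε ℤ.* s⁻) ℤ.+ ε ℤ.* u) shifted ⟨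
    jtp-factor n V m
      ∎
    where
    open ≡-Reasoning
    s⁺ = shift (c⁺ n) V m
    s⁻ = shift (c⁻ n) V m
    X = shift (c⁺ n + c⁻ n) V m
    exponent : a * suc (double n) ≡ c⁺ n + c⁻ n
    exponent = trans (cong (λ t → a * suc t) (double≡+ n)) (lemma b d n)
      where
      lemma : ∀ b d n → (b + d) * suc (n + n) ≡ (b + d) * n + d + ((b + d) * n + b)
      lemma = ℕ-Solver.solve-∀
    shifted : shift (c⁺ n) (factor ε (c⁻ n) V) m ≡ s⁺ ℤ.+ ε ℤ.* X
    shifted = trans (shift-⊕ (c⁺ n) V _ m)
      (cong (λ u → s⁺ ℤ.+ u) (trans (shift-⊛ (c⁺ n) ε _ m) (cong (ε ℤ.*_) (shift-+ (c⁺ n) (c⁻ n) V m))))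
    rearrange : ∀ e v x p q → (v ℤ.+ (e ℤ.* e) ℤ.* x) ℤ.+ e ℤ.* p ℤ.+ e ℤ.* q ≡
                              (v ℤ.+ e ℤ.* q) ℤ.+ e ℤ.* (p ℤ.+ e ℤ.* x)
    rearrange = ℤ-Solver.solve-∀

  finite-triple-product : ∀ n → ∑ (suc (double n)) (jtp-term n) ≈ jtp-product n 1ₛ
  finite-triple-product zero m = trans (ℤₚ.+-identityʳ _) (ℤₚ.*-identityˡ (1ₛ m))
  finite-triple-product (suc n) = begin
    ∑ (3 + N) (jtp-term (suc n))
      ≈⟨ ∑-cong (3 + N) (jtp-term-suc n) ⟩
    ∑ (3 + N) (λ j → A j ⊕ B j ⊕ O₃ (jtp-term n j))
      ≈⟨ ≈-trans (∑-⊕ (3 + N) (λ j → A j ⊕ B j) (O₃ ∘ jtp-term n))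
                 (⊕-cong (∑-⊕ (3 + N) A B) (≈-refl {∑ (3 + N) (O₃ ∘ jtp-term n)})) ⟩
    ∑ (1 + (2 + N)) A ⊕ ∑ (2 + suc N) B ⊕ ∑ (2 + suc N) (O₃ ∘ jtp-term n)
      ≈⟨ ⊕-cong (⊕-cong (∑-after 1 (2 + N) (O₁ ∘ jtp-term n)) (∑-after 2 (suc N) (O₂ ∘ jtp-term n)))
                (≈-refl {∑ (3 + N) (O₃ ∘ jtp-term n)}) ⟩
    ∑ (1 + suc N) (O₁ ∘ jtp-term n) ⊕ ∑ (0 + suc N) (O₂ ∘ jtp-term n) ⊕ ∑ (2 + suc N) (O₃ ∘ jtp-term n)
      ≈⟨ ⊕-cong (⊕-cong (∑-linear-terms O₁-isLinear 1) (∑-linear-terms O₂-isLinear 0)) (∑-linear-terms O₃-isLinear 2) ⟩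
    O₁ V ⊕ O₂ V ⊕ O₃ V
      ≈⟨ jtp-factor-expand n V ⟩
    jtp-factor n V
      ≈⟨ preserves-≈ (isLinear (jtp-factor-isMultiplier n)) (finite-triple-product n) ⟩
    jtp-factor n (jtp-product n 1ₛ)
      ∎
    where
    open ≈-Reasoning
    N = double n
    V = ∑ (suc N) (jtp-term n)
    O₁ O₂ O₃ : Series → Series
    O₁ = factor 1ℤ (a * suc N)
    O₂ = monomial ε (c⁺ n)
    O₃ = monomial ε (c⁻ n)
    A B : ℕ → Series
    A = after 1 (O₁ ∘ jtp-term n)
    B = after 2 (O₂ ∘ jtp-term n)
    O₁-isLinear = factor-isLinear 1ℤ (a * suc N)
    O₂-isLinear = monomial-isLinear ε (c⁺ n)
    O₃-isLinear = monomial-isLinear ε (c⁻ n)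
    ∑-linear-terms : ∀ {O} → IsLinear O → ∀ k → ∑ (k + suc N) (O ∘ jtp-term n) ≈ O V
    ∑-linear-terms {O} A k = ≈-trans
      (∑-extend (suc N) (O ∘ jtp-term n) (λ j N<j → ≈-trans (preserves-≈ A (jtp-term-above n j N<j)) (0ₛ-hom A)) k)
      (≈-sym (linear-∑ A (suc N) (jtp-term n)))

  theta : ℕ → Series → Series
  theta R f = f ⊕ ∑ R (λ i → ε^ (suc i) ⊛ (shift (τ⁻ (suc i)) f ⊕ shift (τ⁺ (suc i)) f))

  theta-isLinear : ∀ R → IsLinear (theta R)
  theta-isLinear R = ⊕-isLinear id-isLinear (∑-isLinear R _ (λ i →
    ∘-isLinear (⊛-isLinear (ε^ (suc i))) (⊕-isLinear (shift-isLinear (τ⁻ (suc i))) (shift-isLinear (τ⁺ (suc i))))))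

  theta-symmetric : ℕ → Series
  theta-symmetric n = ∑ (suc (double n)) (λ j → monomial (σ n j) (τ n j) 1ₛ)

  theta-symmetric≈theta : ∀ n → theta-symmetric n ≈ theta n 1ₛ
  theta-symmetric≈theta zero m = cong (λ t → t ℤ.+ 0ℤ) (ℤₚ.*-identityˡ (1ₛ m))
  theta-symmetric≈theta (suc n) m = begin
    x⁻ ℤ.+ ∑ (suc (suc N)) G m
      ≡⟨ cong (λ t → x⁻ ℤ.+ t) (∑-suc (suc N) G m) ⟩
    x⁻ ℤ.+ (theta-symmetric n m ℤ.+ G (suc N) m)
      ≡⟨ cong₂ (λ u v → x⁻ ℤ.+ (u ℤ.+ v)) (theta-symmetric≈theta n m)
               (monomial-≡ (σ-above n (suc N) n≤N+1) (τ-above n (suc N) n≤N+1) ≈-refl m) ⟩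
    x⁻ ℤ.+ ((1ₛ m ℤ.+ ∑ n H m) ℤ.+ monomial (ε^ (suc N ∸ n)) (τ⁺ (suc N ∸ n)) 1ₛ m)
      ≡⟨ cong (λ k → x⁻ ℤ.+ ((1ₛ m ℤ.+ ∑ n H m) ℤ.+ monomial (ε^ k) (τ⁺ k) 1ₛ m)) N+1∸n ⟩
    x⁻ ℤ.+ ((1ₛ m ℤ.+ ∑ n H m) ℤ.+ ε^ (suc n) ℤ.* shift (τ⁺ (suc n)) 1ₛ m)
      ≡⟨ rearrange (ε^ (suc n)) (shift (τ⁻ (suc n)) 1ₛ m) _ (1ₛ m) (∑ n H m) ⟩
    1ₛ m ℤ.+ (∑ n H m ℤ.+ H n m)
      ≡⟨ cong (λ t → 1ₛ m ℤ.+ t) (∑-suc n H m) ⟨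
    theta (suc n) 1ₛ m
      ∎
    where
    open ≡-Reasoning
    N = double n
    x⁻ = monomial (ε^ (suc n)) (τ⁻ (suc n)) 1ₛ m
    G : ℕ → Series
    G j = monomial (σ n j) (τ n j) 1ₛ
    H : ℕ → Series
    H i = ε^ (suc i) ⊛ (shift (τ⁻ (suc i)) 1ₛ ⊕ shift (τ⁺ (suc i)) 1ₛ)
    n≤N+1 : n ≤ suc N
    n≤N+1 = ℕₚ.m≤n⇒m≤1+n (subst (n ≤_) (sym (double≡+ n)) (ℕₚ.m≤m+n n n))
    N+1∸n : suc N ∸ n ≡ suc n
    N+1∸n = trans (cong (λ t → suc t ∸ n) (double≡+ n)) (ℕₚ.m+n∸n≡m (suc n) n)
    rearrange : ∀ e x y o S → e ℤ.* x ℤ.+ ((o ℤ.+ S) ℤ.+ e ℤ.* y) ≡ o ℤ.+ (S ℤ.+ e ℤ.* (x ℤ.+ y))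
    rearrange = ℤ-Solver.solve-∀

  module _ (1≤a : 1 ≤ a) where

    m≤a*m : ∀ m → m ≤ a * m
    m≤a*m m = subst (_≤ a * m) (ℕₚ.*-identityˡ m) (ℕₚ.*-monoˡ-≤ m 1≤a)

    τ⁺-≥ : ∀ m → m ≤ suc (τ⁺ m)
    τ⁺-≥ zero = z≤n
    τ⁺-≥ (suc m) = s≤s (ℕₚ.≤-trans (m≤a*m m) (ℕₚ.≤-trans (ℕₚ.m≤n+m (a * m) (τ⁺ m)) (ℕₚ.m≤m+n _ d)))

    τ⁻-≥ : ∀ m → m ≤ suc (τ⁻ m)
    τ⁻-≥ zero = z≤n
    τ⁻-≥ (suc m) = s≤s (ℕₚ.≤-trans (m≤a*m m) (ℕₚ.≤-trans (ℕₚ.m≤n+m (a * m) (τ⁻ m)) (ℕₚ.m≤m+n _ b)))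

    +≤τ+a*suc : (τ′ : ℕ → ℕ) → (∀ m → m ≤ suc (τ′ m)) → ∀ t u → t + u ≤ τ′ t + a * suc u
    +≤τ+a*suc τ′ τ′-≥ t u = begin
      t + u              ≤⟨ ℕₚ.+-monoˡ-≤ u (τ′-≥ t) ⟩
      suc (τ′ t) + u     ≡⟨ ℕₚ.+-suc (τ′ t) u ⟨
      τ′ t + suc u       ≤⟨ ℕₚ.+-monoʳ-≤ (τ′ t) (m≤a*m (suc u)) ⟩
      τ′ t + a * suc u   ∎
      where open ℕₚ.≤-Reasoning

    qfac-term-≈[] : ∀ {n j L} → poch 0 n (binom (double n) j) ≈[ L ] 1ₛ → n ≤ τ n j + L →
                    poch 0 n (jtp-term n j) ≈[ n ] monomial (σ n j) (τ n j) 1ₛ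
    qfac-term-≈[] {n} {j} {L} ≈1 n≤τ+L = begin
      poch 0 n (monomial (σ n j) (τ n j) (binom (double n) j))
        ≈⟨ ≈⇒≈[] (commutes (poch-isMultiplier 0 n) (monomial-isLinear (σ n j) (τ n j)) (binom (double n) j)) ⟩
      monomial (σ n j) (τ n j) (poch 0 n (binom (double n) j))
        ≈⟨ ≈[]-mono n≤τ+L (monomial-cong[+] (σ n j) (τ n j) ≈1) ⟩
      monomial (σ n j) (τ n j) 1ₛ
        ∎
      where open ≈[]-Reasoning n

    -- (q; q)_n [2n, j]_q is 1 up to factors 1 − q^i with i > min(j, 2n − j), so it is 1
    -- modulo x^(n − τ n j).
    jtp-term-limit : ∀ n j → j ≤ double n → poch 0 n (jtp-term n j) ≈[ n ] monomial (σ n j) (τ n j) 1ₛ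
    jtp-term-limit n j j≤N with ℕₚ.≤-total j n
    jtp-term-limit n j j≤N | inj₁ j≤n with ℕₚ.m≤n⇒∃[o]m+o≡n j≤n
    ... | r , refl = qfac-term-≈[] {L = a * suc j}
      (subst (λ N → poch 0 n (binom N j) ≈[ a * suc j ] 1ₛ) (sym N≡) (qfac-≈[]-1ₛ j≤n j≤M (qfac-binom M j)))
      (subst (λ t → j + r ≤ t + a * suc j) (sym τ≡) (subst (_≤ τ⁻ r + a * suc j) (ℕₚ.+-comm r j) (+≤τ+a*suc τ⁻ τ⁻-≥ r j)))
      where
      M = r + (j + r)
      N≡ : double n ≡ j + M
      N≡ = trans (double≡+ (j + r)) (ℕₚ.+-assoc j r (j + r))
      j≤M : j ≤ M
      j≤M = ℕₚ.≤-trans j≤n (ℕₚ.m≤n+m (j + r) r)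
      τ≡ : τ n j ≡ τ⁻ r
      τ≡ = trans (τ-below (j + r) j j≤n) (cong τ⁻ (ℕₚ.m+n∸m≡n j r))
    jtp-term-limit n j j≤N | inj₂ n≤j with ℕₚ.m≤n⇒∃[o]m+o≡n n≤j | ℕₚ.m≤n⇒∃[o]m+o≡n j≤N
    ... | t , refl | u , j+u≡N = qfac-term-≈[] {L = a * suc u}
      (subst (λ N → poch 0 n (binom N j) ≈[ a * suc u ] 1ₛ) j+u≡N (qfac-≈[]-1ₛ u≤n (ℕₚ.≤-trans u≤n n≤j) (qfac-binom′ j u)))
      (subst (λ t′ → n ≤ t′ + a * suc u) (sym τ≡) (subst (_≤ τ⁺ t + a * suc u) (sym n≡) (+≤τ+a*suc τ⁺ τ⁺-≥ t u)))
      where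
      n≡ : n ≡ t + u
      n≡ = ℕₚ.+-cancelˡ-≡ n n (t + u) (trans (sym (double≡+ n)) (trans (sym j+u≡N) (ℕₚ.+-assoc n t u)))
      u≤n : u ≤ n
      u≤n = subst (u ≤_) (sym n≡) (ℕₚ.m≤n+m u t)
      τ≡ : τ n j ≡ τ⁺ t
      τ≡ = trans (τ-above n j n≤j) (cong τ⁺ (ℕₚ.m+n∸m≡n n t))

    triple-product-mod : ∀ n → poch 0 n (jtp-product n 1ₛ) ≈[ n ] theta n 1ₛ
    triple-product-mod n = begin
      poch 0 n (jtp-product n 1ₛ)                  ≈⟨ ≈⇒≈[] (preserves-≈ P (finite-triple-product n)) ⟨
      poch 0 n (∑ (suc (double n)) (jtp-term n))   ≈⟨ ≈⇒≈[] (linear-∑ P (suc (double n)) (jtp-term n)) ⟩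
      ∑ (suc (double n)) (poch 0 n ∘ jtp-term n)   ≈⟨ ∑-cong[] (suc (double n)) (λ j j≤N → jtp-term-limit n j (ℕₚ.≤-pred j≤N)) ⟩
      theta-symmetric n                            ≈⟨ ≈⇒≈[] (theta-symmetric≈theta n) ⟩
      theta n 1ₛ                                   ∎
      where
      open ≈[]-Reasoning n
      P = isLinear (poch-isMultiplier 0 n)

-- Euler's and Gauss's identities

product : ℤ → ℕ → Series → Series
product c n = ∏ n (λ i → factor c (suc i))

product-isMultiplier : ∀ c n → IsMultiplier (product c n)
product-isMultiplier c n = ∏-isMultiplier n _ (λ i → factor-isMultiplier c (suc i))

product-≈[] : ∀ c {L m} → L ≤ m → ∀ f → product c m f ≈[ suc L ] product c L f
product-≈[] c {L} L≤m f = ∏-stable (suc L) L _ (λ i L≤i → factor-isIdentityMod c (suc i) (s≤s L≤i)) _ L≤m f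

euler∘distinct-≈[] : ∀ {L m m′} → L ≤ m → L ≤ m′ → ∀ f →
                     product -1ℤ m (product 1ℤ m′ f) ≈[ L ] product -1ℤ L (product 1ℤ L f)
euler∘distinct-≈[] {L} {m} {m′} L≤m L≤m′ f = ≈[]-mono (ℕₚ.n≤1+n L) (≈[]-trans (product-≈[] -1ℤ L≤m (product 1ℤ m′ f))
  (preserves-≈[] (isLinear (product-isMultiplier -1ℤ L)) (product-≈[] 1ℤ L≤m′ f)))

product₂ : ℕ → Series → Series
product₂ n = ∏ n (λ i → factor -1ℤ (suc i + suc i))

factor-square : ∀ k f → factor -1ℤ (k + k) f ≈ factor -1ℤ k (factor 1ℤ k f)
factor-square k f m = begin
  f m ℤ.+ -1ℤ ℤ.* shift (k + k) f m
    ≡⟨ difference-of-squares (f m) (shift k f m) (shift (k + k) f m) ⟩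
  (f m ℤ.+ 1ℤ ℤ.* shift k f m) ℤ.+ -1ℤ ℤ.* (shift k f m ℤ.+ 1ℤ ℤ.* shift (k + k) f m)
    ≡⟨ cong (λ t → (f m ℤ.+ 1ℤ ℤ.* shift k f m) ℤ.+ -1ℤ ℤ.* t) shifted ⟨
  factor -1ℤ k (factor 1ℤ k f) m
    ∎
  where
  open ≡-Reasoning
  shifted : shift k (factor 1ℤ k f) m ≡ shift k f m ℤ.+ 1ℤ ℤ.* shift (k + k) f m
  shifted = trans (shift-⊕ k f _ m) (cong (λ t → shift k f m ℤ.+ t)
    (trans (shift-⊛ k 1ℤ (shift k f) m) (cong (1ℤ ℤ.*_) (shift-+ k k f m))))
  difference-of-squares : ∀ x y z → x ℤ.+ -1ℤ ℤ.* z ≡ (x ℤ.+ 1ℤ ℤ.* y) ℤ.+ -1ℤ ℤ.* (y ℤ.+ 1ℤ ℤ.* z)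
  difference-of-squares = ℤ-Solver.solve-∀

product₂-split : ∀ n f → product₂ n f ≈ product -1ℤ n (product 1ℤ n f)
product₂-split zero f = ≈-refl
product₂-split (suc n) f = begin
  factor -1ℤ (suc n + suc n) (product₂ n f)
    ≈⟨ preserves-≈ (factor-isLinear -1ℤ (suc n + suc n)) (product₂-split n f) ⟩
  factor -1ℤ (suc n + suc n) (product -1ℤ n (product 1ℤ n f))
    ≈⟨ factor-square (suc n) (product -1ℤ n (product 1ℤ n f)) ⟩
  factor -1ℤ (suc n) (factor 1ℤ (suc n) (product -1ℤ n (product 1ℤ n f)))
    ≈⟨ preserves-≈ (factor-isLinear -1ℤ (suc n)) (commutes (factor-isMultiplier 1ℤ (suc n)) (isLinear (product-isMultiplier -1ℤ n)) _) ⟩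
  factor -1ℤ (suc n) (product -1ℤ n (factor 1ℤ (suc n) (product 1ℤ n f)))
    ∎
  where open ≈-Reasoning

module Pentagonal = TripleProduct 2 4 -1ℤ refl

triple : ℕ → ℕ
triple zero = zero
triple (suc n) = suc (suc (suc (triple n)))

n≤triple : ∀ n → n ≤ triple n
n≤triple zero = z≤n
n≤triple (suc n) = s≤s (ℕₚ.≤-trans (n≤triple n) (ℕₚ.≤-trans (ℕₚ.n≤1+n _) (ℕₚ.n≤1+n _)))

-- With q = x^6 the triple product is Euler's product in x², three factors per step.
pentagonal-product : ∀ n → Pentagonal.poch 0 n (Pentagonal.jtp-product n 1ₛ) ≈ product₂ (triple n) 1ₛ
pentagonal-product zero = ≈-refl
pentagonal-product (suc n) = begin
  factor -1ℤ (6 * suc n) (Pentagonal.poch 0 n (O (Pentagonal.jtp-product n 1ₛ)))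
    ≈⟨ preserves-≈ (factor-isLinear -1ℤ (6 * suc n)) (commutes (Pentagonal.poch-isMultiplier 0 n) O-isLinear _) ⟩
  factor -1ℤ (6 * suc n) (O (Pentagonal.poch 0 n (Pentagonal.jtp-product n 1ₛ)))
    ≈⟨ preserves-≈ (∘-isLinear (factor-isLinear -1ℤ (6 * suc n)) O-isLinear) (pentagonal-product n) ⟩
  factor -1ℤ (6 * suc n) (factor -1ℤ (6 * n + 4) (factor -1ℤ (6 * n + 2) Y))
    ≈⟨ factor-≡ -1ℤ exponent₃ (factor -1ℤ (6 * n + 4) (factor -1ℤ (6 * n + 2) Y)) ⟩
  factor -1ℤ (k 3) (factor -1ℤ (6 * n + 4) (factor -1ℤ (6 * n + 2) Y))
    ≈⟨ preserves-≈ (factor-isLinear -1ℤ (k 3)) (factor-≡ -1ℤ (exponent 2) (factor -1ℤ (6 * n + 2) Y)) ⟩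
  factor -1ℤ (k 3) (factor -1ℤ (k 2) (factor -1ℤ (6 * n + 2) Y))
    ≈⟨ preserves-≈ (∘-isLinear (factor-isLinear -1ℤ (k 3)) (factor-isLinear -1ℤ (k 2))) (factor-≡ -1ℤ (exponent 1) Y) ⟩
  factor -1ℤ (k 3) (factor -1ℤ (k 2) (factor -1ℤ (k 1) Y))
    ∎
  where
  open ≈-Reasoning
  Y = product₂ (triple n) 1ₛ
  O = Pentagonal.jtp-factor n
  O-isLinear = isLinear (Pentagonal.jtp-factor-isMultiplier n)
  k : ℕ → ℕ
  k i = (i + triple n) + (i + triple n)
  triple≡ : ∀ n → triple n ≡ 3 * n
  triple≡ zero = refl
  triple≡ (suc n) = trans (cong (λ t → 3 + t) (triple≡ n)) (sym (ℕₚ.*-distribˡ-+ 3 1 n))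
  exponent : ∀ i → 6 * n + 2 * i ≡ k i
  exponent i = trans (lemma i n) (cong (λ t → (i + t) + (i + t)) (sym (triple≡ n)))
    where
    lemma : ∀ i n → 6 * n + 2 * i ≡ (i + 3 * n) + (i + 3 * n)
    lemma = ℕ-Solver.solve-∀
  exponent₃ : 6 * suc n ≡ k 3
  exponent₃ = trans (ℕₚ.*-suc 6 n) (trans (ℕₚ.+-comm 6 (6 * n)) (exponent 3))

pentagonal-mod : ∀ L → Pentagonal.theta L 1ₛ ≈[ L ] product -1ℤ L (product 1ℤ L 1ₛ)
pentagonal-mod L = begin
  Pentagonal.theta L 1ₛ                              ≈⟨ Pentagonal.triple-product-mod (s≤s z≤n) L ⟨
  Pentagonal.poch 0 L (Pentagonal.jtp-product L 1ₛ)  ≈⟨ ≈⇒≈[] (pentagonal-product L) ⟩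
  product₂ (triple L) 1ₛ                             ≈⟨ ≈⇒≈[] (product₂-split (triple L) 1ₛ) ⟩
  product -1ℤ (triple L) (product 1ℤ (triple L) 1ₛ)  ≈⟨ euler∘distinct-≈[] (n≤triple L) (n≤triple L) 1ₛ ⟩
  product -1ℤ L (product 1ℤ L 1ₛ)                    ∎
  where open ≈[]-Reasoning L

module Gauss = TripleProduct 0 1 1ℤ refl

T : ℕ → ℕ
T = Gauss.τ⁺

l≤1+T : ∀ l → l ≤ suc (T l)
l≤1+T = Gauss.τ⁺-≥ ℕₚ.≤-refl

ψ : ℕ → Series
ψ N = ∑ N (λ l → shift (T l) 1ₛ)

gauss-poch : ∀ n f → Gauss.poch 0 n f ≈ product -1ℤ n f
gauss-poch n = ∏-cong n (λ i → factor-≡ -1ℤ (ℕₚ.*-identityˡ (suc i))) (λ i → factor-isLinear -1ℤ (suc i))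

-- The factor 1 + x⁰ = 2 of Gauss's product.
gauss-product : ∀ n f → Gauss.jtp-product (suc n) f ≈ + 2 ⊛ product 1ℤ (suc n) (product 1ℤ n f)
gauss-product zero f = ≈-trans (preserves-≈ (factor-isLinear 1ℤ 1) doubled) (⊛-hom (factor-isLinear 1ℤ 1) (+ 2) f)
  where
  doubled : factor 1ℤ 0 f ≈ + 2 ⊛ f
  doubled m = twice (f m)
    where
    twice : ∀ x → x ℤ.+ 1ℤ ℤ.* x ≡ + 2 ℤ.* x
    twice = ℤ-Solver.solve-∀
gauss-product (suc n) f = begin
  Gauss.jtp-factor (suc n) (Gauss.jtp-product (suc n) f)
    ≈⟨ ≈-trans (factor-≡ 1ℤ (exponent 1) (factor 1ℤ (1 * suc n + 0) G))
               (preserves-≈ (factor-isLinear 1ℤ (2 + n)) (factor-≡ 1ℤ (exponent 0) G)) ⟩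
  factor 1ℤ (2 + n) (factor 1ℤ (1 + n) (Gauss.jtp-product (suc n) f))
    ≈⟨ preserves-≈ (∘-isLinear (factor-isLinear 1ℤ (2 + n)) (factor-isLinear 1ℤ (1 + n))) (gauss-product n f) ⟩
  factor 1ℤ (2 + n) (factor 1ℤ (1 + n) (+ 2 ⊛ P))
    ≈⟨ ≈-trans (preserves-≈ (factor-isLinear 1ℤ (2 + n)) (⊛-hom (factor-isLinear 1ℤ (1 + n)) (+ 2) P))
               (⊛-hom (factor-isLinear 1ℤ (2 + n)) (+ 2) (factor 1ℤ (1 + n) P)) ⟩
  + 2 ⊛ factor 1ℤ (2 + n) (factor 1ℤ (1 + n) P)
    ≈⟨ ⊛-cong (+ 2) (preserves-≈ (factor-isLinear 1ℤ (2 + n))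
         (commutes (factor-isMultiplier 1ℤ (1 + n)) (isLinear (product-isMultiplier 1ℤ (suc n))) (product 1ℤ n f))) ⟩
  + 2 ⊛ factor 1ℤ (2 + n) (product 1ℤ (suc n) (factor 1ℤ (1 + n) (product 1ℤ n f)))
    ∎
  where
  open ≈-Reasoning
  G = Gauss.jtp-product (suc n) f
  P = product 1ℤ (suc n) (product 1ℤ n f)
  exponent : ∀ i → 1 * suc n + i ≡ i + suc n
  exponent i = trans (cong (λ t → t + i) (ℕₚ.*-identityˡ (suc n))) (ℕₚ.+-comm (suc n) i)

gauss-theta : ∀ N → Gauss.theta N 1ₛ ≈ + 2 ⊛ ψ N ⊕ shift (T N) 1ₛ
gauss-theta zero m = trans (ℤₚ.+-identityʳ (1ₛ m)) (sym (ℤₚ.+-identityˡ (1ₛ m)))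
gauss-theta (suc N) m = begin
  1ₛ m ℤ.+ ∑ (suc N) H m
    ≡⟨ cong (λ t → 1ₛ m ℤ.+ t) (∑-suc N H m) ⟩
  1ₛ m ℤ.+ (∑ N H m ℤ.+ H N m)
    ≡⟨ ℤₚ.+-assoc (1ₛ m) (∑ N H m) (H N m) ⟨
  Gauss.theta N 1ₛ m ℤ.+ H N m
    ≡⟨ cong₂ ℤ._+_ (gauss-theta N m)
               (cong₂ (λ e k → e ℤ.* (shift k 1ₛ m ℤ.+ y)) (ε^≡1 (suc N)) (τ⁻-suc N)) ⟩
  (+ 2 ℤ.* ψ N m ℤ.+ x) ℤ.+ 1ℤ ℤ.* (x ℤ.+ y)
    ≡⟨ rearrange (ψ N m) x y ⟩
  + 2 ℤ.* (ψ N m ℤ.+ x) ℤ.+ y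
    ≡⟨ cong (λ t → + 2 ℤ.* t ℤ.+ y) (∑-suc N (λ l → shift (T l) 1ₛ) m) ⟨
  + 2 ℤ.* ψ (suc N) m ℤ.+ y
    ∎
  where
  open ≡-Reasoning
  H : ℕ → Series
  H i = Gauss.ε^ (suc i) ⊛ (shift (Gauss.τ⁻ (suc i)) 1ₛ ⊕ shift (T (suc i)) 1ₛ)
  x = shift (T N) 1ₛ m
  y = shift (T (suc N)) 1ₛ m
  ε^≡1 : ∀ k → Gauss.ε^ k ≡ 1ℤ
  ε^≡1 zero = refl
  ε^≡1 (suc k) = trans (ℤₚ.*-identityˡ _) (ε^≡1 k)
  τ⁻-suc : ∀ i → Gauss.τ⁻ (suc i) ≡ T i
  τ⁻-suc zero = refl
  τ⁻-suc (suc i) = trans (cong (λ t → t + 1 * suc i + 0) (τ⁻-suc i)) (lemma (T i) i)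
    where
    lemma : ∀ t i → t + 1 * suc i + 0 ≡ t + 1 * i + 1
    lemma = ℕ-Solver.solve-∀
  rearrange : ∀ p x y → (+ 2 ℤ.* p ℤ.+ x) ℤ.+ 1ℤ ℤ.* (x ℤ.+ y) ≡ + 2 ℤ.* (p ℤ.+ x) ℤ.+ y
  rearrange = ℤ-Solver.solve-∀

gauss-mod : ∀ L → + 2 ⊛ product -1ℤ L (product 1ℤ L (product 1ℤ L 1ₛ)) ≈[ L ] + 2 ⊛ ψ (suc L)
gauss-mod L = begin
  + 2 ⊛ product -1ℤ L (product 1ℤ L (product 1ℤ L 1ₛ))
    ≈⟨ ⊛-cong[] (+ 2) (euler∘distinct-≈[] (ℕₚ.n≤1+n L) (ℕₚ.n≤1+n L) (product 1ℤ L 1ₛ)) ⟨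
  + 2 ⊛ product -1ℤ (suc L) (product 1ℤ (suc L) (product 1ℤ L 1ₛ))
    ≈⟨ ≈⇒≈[] (⊛-hom (isLinear (product-isMultiplier -1ℤ (suc L))) (+ 2) _) ⟨
  product -1ℤ (suc L) (+ 2 ⊛ product 1ℤ (suc L) (product 1ℤ L 1ₛ))
    ≈⟨ ≈⇒≈[] (preserves-≈ (isLinear (product-isMultiplier -1ℤ (suc L))) (gauss-product L 1ₛ)) ⟨
  product -1ℤ (suc L) (Gauss.jtp-product (suc L) 1ₛ)
    ≈⟨ ≈⇒≈[] (gauss-poch (suc L) _) ⟨
  Gauss.poch 0 (suc L) (Gauss.jtp-product (suc L) 1ₛ)
    ≈⟨ ≈[]-mono (ℕₚ.n≤1+n L) (Gauss.triple-product-mod ℕₚ.≤-refl (suc L)) ⟩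
  Gauss.theta (suc L) 1ₛ
    ≈⟨ ≈⇒≈[] (gauss-theta (suc L)) ⟩
  + 2 ⊛ ψ (suc L) ⊕ shift (T (suc L)) 1ₛ
    ≈⟨ ⊕-cong[] (≈[]-refl {f = + 2 ⊛ ψ (suc L)}) (shift-≈[]-0ₛ (T (suc L)) 1ₛ (ℕₚ.≤-pred (l≤1+T (suc L)))) ⟩
  + 2 ⊛ ψ (suc L) ⊕ 0ₛ
    ≈⟨ ≈⇒≈[] (λ m → ℤₚ.+-identityʳ (+ 2 ℤ.* ψ (suc L) m)) ⟩
  + 2 ⊛ ψ (suc L)
    ∎
  where open ≈[]-Reasoning L

pentagonal-theta-distinct : ∀ L Q → Q ≈[ L ] product 1ℤ L 1ₛ → Pentagonal.theta L Q ≈[ L ] ψ (suc L)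
pentagonal-theta-distinct L Q Q≈ n n<L = ℤₚ.*-cancelˡ-≡ (+ 2) _ _ (doubled n n<L)
  where
  D = product-isMultiplier 1ℤ L
  doubled : + 2 ⊛ Pentagonal.theta L Q ≈[ L ] + 2 ⊛ ψ (suc L)
  doubled = begin
    + 2 ⊛ Pentagonal.theta L Q
      ≈⟨ ⊛-cong[] (+ 2) (preserves-≈[] (Pentagonal.theta-isLinear L) Q≈) ⟩
    + 2 ⊛ Pentagonal.theta L (product 1ℤ L 1ₛ)
      ≈⟨ ⊛-cong[] (+ 2) (≈⇒≈[] (commutes D (Pentagonal.theta-isLinear L) 1ₛ)) ⟨
    + 2 ⊛ product 1ℤ L (Pentagonal.theta L 1ₛ)
      ≈⟨ ⊛-cong[] (+ 2) (preserves-≈[] (isLinear D) (pentagonal-mod L)) ⟩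
    + 2 ⊛ product 1ℤ L (product -1ℤ L (product 1ℤ L 1ₛ))
      ≈⟨ ⊛-cong[] (+ 2) (≈⇒≈[] (commutes D (isLinear (product-isMultiplier -1ℤ L)) (product 1ℤ L 1ₛ))) ⟩
    + 2 ⊛ product -1ℤ L (product 1ℤ L (product 1ℤ L 1ₛ))
      ≈⟨ gauss-mod L ⟩
    + 2 ⊛ ψ (suc L)
      ∎
    where open ≈[]-Reasoning L

-- The series of q, s and E

shift-if : ∀ k f m → shift k f m ≡ (if k ≤ᵇ m then f (m ∸ k) else 0ℤ)
shift-if zero f m = refl
shift-if (suc zero) f zero = refl
shift-if (suc zero) f (suc m) = refl
shift-if (suc (suc k)) f zero = refl
shift-if (suc (suc k)) f (suc m) = shift-if (suc k) f m

length-++-if : ∀ {A B : Set} c (X : List A) (g : B → A) (Y : List B) →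
  + length (X ++ (if c then map g Y else [])) ≡ + length X ℤ.+ (if c then + length Y else 0ℤ)
length-++-if true X g Y =
  trans (cong +_ (trans (Listₚ.length-++ X) (cong (λ t → length X + t) (Listₚ.length-map g Y)))) (ℤₚ.pos-+ (length X) (length Y))
length-++-if false X g Y = trans (cong +_ (trans (Listₚ.length-++ X) (ℕₚ.+-identityʳ _))) (sym (ℤₚ.+-identityʳ _))

distinct-parts : ℕ → Series
distinct-parts b m = + length (distPartsBelow (suc b) m)

-- Split off the part b + 1, if present.
distinct-parts-suc : ∀ b → distinct-parts (suc b) ≈ factor 1ℤ (suc b) (distinct-parts b)
distinct-parts-suc b m = begin
  + length (distPartsBelow (suc b) m ++ (if suc b ≤ᵇ m then map (suc b ∷_) (distPartsBelow (suc b) (m ∸ suc b)) else []))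
    ≡⟨ length-++-if (suc b ≤ᵇ m) (distPartsBelow (suc b) m) (suc b ∷_) _ ⟩
  distinct-parts b m ℤ.+ (if suc b ≤ᵇ m then distinct-parts b (m ∸ suc b) else 0ℤ)
    ≡⟨ cong (λ t → distinct-parts b m ℤ.+ t) (shift-if (suc b) (distinct-parts b) m) ⟨
  distinct-parts b m ℤ.+ shift (suc b) (distinct-parts b) m
    ≡⟨ cong (λ t → distinct-parts b m ℤ.+ t) (ℤₚ.*-identityˡ (shift (suc b) (distinct-parts b) m)) ⟨
  factor 1ℤ (suc b) (distinct-parts b) m
    ∎
  where open ≡-Reasoning

distinct-parts-gf : ∀ b → distinct-parts b ≈ product 1ℤ b 1ₛ
distinct-parts-gf zero zero = refl
distinct-parts-gf zero (suc m) = refl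
distinct-parts-gf (suc b) = ≈-trans (distinct-parts-suc b) (preserves-≈ (factor-isLinear 1ℤ (suc b)) (distinct-parts-gf b))

q-series : Series
q-series m = + q m

q-series-≈[] : ∀ L → q-series ≈[ L ] product 1ℤ L 1ₛ
q-series-≈[] L m m<L = trans (distinct-parts-gf m m) (sym (product-≈[] 1ℤ (ℕₚ.<⇒≤ m<L) 1ₛ m (ℕₚ.n<1+n m)))

shift-via-⊖ : ∀ (F : ℤ → ℤ) → (∀ n → F ℤ.-[1+ n ] ≡ 0ℤ) → ∀ m c → F (m ℤ.⊖ c) ≡ shift c (F ∘ +_) m
shift-via-⊖ F neg m zero = refl
shift-via-⊖ F neg zero (suc c) = neg c
shift-via-⊖ F neg (suc m) (suc c) = trans (cong F (ℤₚ.[1+m]⊖[1+n]≡m⊖n m c)) (shift-via-⊖ F neg m c)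

s-series : Series
s-series h = s (+ h)

s-at-difference : ∀ m c → s (+ m ℤ.- + c) ≡ shift c s-series m
s-at-difference m c = trans (cong s (ℤₚ.m-n≡m⊖n m c)) (shift-via-⊖ s (λ _ → refl) m c)

second-difference : Series → Series
second-difference f = factor -1ℤ 1 (factor -1ℤ 1 f)

second-difference-isMultiplier : IsMultiplier second-difference
second-difference-isMultiplier = ∘-isMultiplier (factor-isMultiplier -1ℤ 1) (factor-isMultiplier -1ℤ 1)

s-series≈ : s-series ≈ second-difference q-series
s-series≈ h = begin
  q-series h ℤ.- + 2 ℤ.* qℤ (+ h ℤ.- + 1) ℤ.+ qℤ (+ h ℤ.- + 2)
    ≡⟨ cong₂ (λ u v → q-series h ℤ.- + 2 ℤ.* u ℤ.+ v) (q-at-difference 1) (q-at-difference 2) ⟩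
  q-series h ℤ.- + 2 ℤ.* shift 1 q-series h ℤ.+ shift 2 q-series h
    ≡⟨ rearrange (q-series h) (shift 1 q-series h) (shift 2 q-series h) ⟩
  (q-series h ℤ.+ -1ℤ ℤ.* shift 1 q-series h) ℤ.+ -1ℤ ℤ.* (shift 1 q-series h ℤ.+ -1ℤ ℤ.* shift 2 q-series h)
    ≡⟨ cong (λ t → (q-series h ℤ.+ -1ℤ ℤ.* shift 1 q-series h) ℤ.+ -1ℤ ℤ.* t) shifted ⟨
  second-difference q-series h
    ∎
  where
  open ≡-Reasoning
  q-at-difference : ∀ c → qℤ (+ h ℤ.- + c) ≡ shift c q-series h
  q-at-difference c = trans (cong qℤ (ℤₚ.m-n≡m⊖n h c)) (shift-via-⊖ qℤ (λ _ → refl) h c)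
  shifted : shift 1 (factor -1ℤ 1 q-series) h ≡ shift 1 q-series h ℤ.+ -1ℤ ℤ.* shift 2 q-series h
  shifted = trans (shift-⊕ 1 q-series _ h)
    (cong (λ t → shift 1 q-series h ℤ.+ t) (trans (shift-⊛ 1 -1ℤ (shift 1 q-series) h) (cong (-1ℤ ℤ.*_) (shift-+ 1 1 q-series h))))
  rearrange : ∀ q a b → q ℤ.- + 2 ℤ.* a ℤ.+ b ≡ (q ℤ.+ -1ℤ ℤ.* a) ℤ.+ -1ℤ ℤ.* (a ℤ.+ -1ℤ ℤ.* b)
  rearrange = ℤ-Solver.solve-∀

Pentagonal-τ⁺ : ∀ k → Pentagonal.τ⁺ k ≡ 3 * k * k + k
Pentagonal-τ⁺ zero = refl
Pentagonal-τ⁺ (suc k) = trans (cong (λ t → t + 6 * k + 4) (Pentagonal-τ⁺ k)) (lemma k)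
  where
  lemma : ∀ k → 3 * k * k + k + 6 * k + 4 ≡ 3 * suc k * suc k + suc k
  lemma = ℕ-Solver.solve-∀

Pentagonal-τ⁻ : ∀ k → Pentagonal.τ⁻ k + k ≡ 3 * k * k
Pentagonal-τ⁻ zero = refl
Pentagonal-τ⁻ (suc k) = trans (lemma (Pentagonal.τ⁻ k) k) (trans (cong (λ t → t + 6 * k + 3) (Pentagonal-τ⁻ k)) (lemma′ k))
  where
  lemma : ∀ t k → t + 6 * k + 2 + suc k ≡ t + k + 6 * k + 3
  lemma = ℕ-Solver.solve-∀
  lemma′ : ∀ k → 3 * k * k + 6 * k + 3 ≡ 3 * suc k * suc k
  lemma′ = ℕ-Solver.solve-∀

sgn≡ε^ : ∀ k → sgn k ≡ Pentagonal.ε^ k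
sgn≡ε^ zero = refl
sgn≡ε^ (suc k) = trans (cong -_ (sgn≡ε^ k)) (sym (ℤₚ.-1*i≡-i (Pentagonal.ε^ k)))

term≡ : ∀ m i → term m (suc i) ≡
  (Pentagonal.ε^ (suc i) ⊛ (shift (Pentagonal.τ⁻ (suc i)) s-series ⊕ shift (Pentagonal.τ⁺ (suc i)) s-series)) m
term≡ m i = cong₂ ℤ._*_ (sgn≡ε^ (suc i)) (cong₂ ℤ._+_
  (trans (cong s (argument⁻ (suc i))) (s-at-difference m (Pentagonal.τ⁻ (suc i))))
  (trans (cong s (argument⁺ (suc i))) (s-at-difference m (Pentagonal.τ⁺ (suc i)))))
  where
  argument⁻ : ∀ k → + m ℤ.- + (3 * k * k) ℤ.+ + k ≡ + m ℤ.- + Pentagonal.τ⁻ k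
  argument⁻ k = begin
    + m ℤ.- + (3 * k * k) ℤ.+ + k                  ≡⟨ cong (λ t → + m ℤ.- + t ℤ.+ + k) (Pentagonal-τ⁻ k) ⟨
    + m ℤ.- + (Pentagonal.τ⁻ k + k) ℤ.+ + k        ≡⟨ cong (λ t → + m ℤ.- t ℤ.+ + k) (ℤₚ.pos-+ (Pentagonal.τ⁻ k) k) ⟩
    + m ℤ.- (+ Pentagonal.τ⁻ k ℤ.+ + k) ℤ.+ + k    ≡⟨ cancel (+ m) (+ Pentagonal.τ⁻ k) (+ k) ⟩
    + m ℤ.- + Pentagonal.τ⁻ k                      ∎
    where
    open ≡-Reasoning
    cancel : ∀ x y z → x ℤ.- (y ℤ.+ z) ℤ.+ z ≡ x ℤ.- y
    cancel = ℤ-Solver.solve-∀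
  argument⁺ : ∀ k → + m ℤ.- + (3 * k * k) ℤ.- + k ≡ + m ℤ.- + Pentagonal.τ⁺ k
  argument⁺ k = begin
    + m ℤ.- + (3 * k * k) ℤ.- + k      ≡⟨ sub-sub (+ m) (+ (3 * k * k)) (+ k) ⟩
    + m ℤ.- (+ (3 * k * k) ℤ.+ + k)    ≡⟨ cong (λ t → + m ℤ.- t) (ℤₚ.pos-+ (3 * k * k) k) ⟨
    + m ℤ.- + (3 * k * k + k)          ≡⟨ cong (λ t → + m ℤ.- + t) (Pentagonal-τ⁺ k) ⟨
    + m ℤ.- + Pentagonal.τ⁺ k          ∎
    where
    open ≡-Reasoning
    sub-sub : ∀ x y z → x ℤ.- y ℤ.- z ≡ x ℤ.- (y ℤ.+ z)
    sub-sub = ℤ-Solver.solve-∀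

sumℤ-applyUpTo : ∀ N (g : ℕ → ℤ) (F : ℕ → Series) m → (∀ i → g i ≡ F i m) → sumℤ (applyUpTo g N) ≡ ∑ N F m
sumℤ-applyUpTo zero g F m g≡ = refl
sumℤ-applyUpTo (suc N) g F m g≡ = cong₂ ℤ._+_ (g≡ 0) (sumℤ-applyUpTo N (g ∘ suc) (F ∘ suc) m (g≡ ∘ suc))

E≡theta : ∀ m → E m ≡ Pentagonal.theta (suc m) s-series m
E≡theta m = cong (λ t → s (+ m) ℤ.+ t) (sumℤ-applyUpTo (suc m) (λ i → term m (suc i)) summand m (term≡ m))
  where
  summand : ℕ → Series
  summand i = Pentagonal.ε^ (suc i) ⊛ (shift (Pentagonal.τ⁻ (suc i)) s-series ⊕ shift (Pentagonal.τ⁺ (suc i)) s-series)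

E≡second-difference : ∀ m → E m ≡ second-difference (ψ (2 + m)) m
E≡second-difference m = begin
  E m                                              ≡⟨ E≡theta m ⟩
  Θ s-series m                                     ≡⟨ preserves-≈ (Pentagonal.theta-isLinear (suc m)) s-series≈ m ⟩
  Θ (second-difference q-series) m                 ≡⟨ commutes second-difference-isMultiplier (Pentagonal.theta-isLinear (suc m)) q-series m ⟨
  second-difference (Θ q-series) m                 ≡⟨ preserves-≈[] (isLinear second-difference-isMultiplier) ψ-mod m (ℕₚ.n<1+n m) ⟩
  second-difference (ψ (2 + m)) m                  ∎
  where
  open ≡-Reasoning
  Θ = Pentagonal.theta (suc m)
  ψ-mod : Θ q-series ≈[ suc m ] ψ (2 + m)
  ψ-mod = pentagonal-theta-distinct (suc m) q-series (q-series-≈[] (suc m))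

-- Triangular numbers

T-suc : ∀ l → T (suc l) ≡ T l + suc l
T-suc l = lemma (T l) l
  where
  lemma : ∀ t l → t + 1 * l + 1 ≡ t + suc l
  lemma = ℕ-Solver.solve-∀

tri≡T : ∀ l → tri l ≡ T l
tri≡T l = trans (cong (λ t → t / 2) (sym (double-T l))) (m*n/n≡m (T l) 2)
  where
  double-T : ∀ l → T l * 2 ≡ l * suc l
  double-T zero = refl
  double-T (suc l) = trans (cong (λ t → t * 2) (T-suc l)) (trans (lemma (T l) l) (trans (cong (λ t → t + 2 * suc l) (double-T l)) (lemma′ l)))
    where
    lemma : ∀ t l → (t + suc l) * 2 ≡ t * 2 + 2 * suc l
    lemma = ℕ-Solver.solve-∀
    lemma′ : ∀ l → l * suc l + 2 * suc l ≡ suc l * suc (suc l)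
    lemma′ = ℕ-Solver.solve-∀

T-<-suc : ∀ l → T l < T (suc l)
T-<-suc l = subst (T l <_) (sym (T-suc l)) (ℕₚ.m<m+n (T l) (s≤s z≤n))

T-mono-≤ : ∀ {i j} → i ≤ j → T i ≤ T j
T-mono-≤ {j = zero} z≤n = ℕₚ.≤-refl
T-mono-≤ {i} {suc j} i≤1+j with ℕₚ.m≤n⇒m<n∨m≡n i≤1+j
... | inj₂ refl = ℕₚ.≤-refl
... | inj₁ (s≤s i≤j) = ℕₚ.≤-trans (T-mono-≤ i≤j) (ℕₚ.<⇒≤ (T-<-suc j))

T-mono-< : ∀ {i j} → i < j → T i < T j
T-mono-< {i} i<j = ℕₚ.<-≤-trans (T-<-suc i) (T-mono-≤ i<j)

T-gap : ∀ i l r → 0 < r → r ≤ l → T i ≢ T l + r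
T-gap i l r 0<r r≤l with ℕₚ.≤-<-connex i l
... | inj₁ i≤l = ℕₚ.<⇒≢ (ℕₚ.≤-<-trans (T-mono-≤ i≤l) (ℕₚ.m<m+n (T l) 0<r))
... | inj₂ l<i = ℕₚ.<⇒≢ (ℕₚ.<-≤-trans T+r<T[1+l] (T-mono-≤ l<i)) ∘ sym
  where
  T+r<T[1+l] : T l + r < T (suc l)
  T+r<T[1+l] = subst (T l + r <_) (sym (T-suc l)) (ℕₚ.+-monoʳ-< (T l) (s≤s r≤l))

ψ-≢T : ∀ N h → (∀ i → i < N → T i ≢ h) → ψ N h ≡ 0ℤ
ψ-≢T zero h _ = refl
ψ-≢T (suc N) h T≢h = trans (∑-suc N (λ l → shift (T l) 1ₛ) h)
  (cong₂ ℤ._+_ (ψ-≢T N h (λ i i<N → T≢h i (ℕₚ.m<n⇒m<1+n i<N))) (shift-1ₛ-off (T N) h (T≢h N (ℕₚ.n<1+n N))))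

ψ-T : ∀ N l → l < N → ψ N (T l) ≡ 1ℤ
ψ-T (suc N) l (s≤s l≤N) with ℕₚ.m≤n⇒m<n∨m≡n l≤N
... | inj₂ refl = trans (∑-suc l (λ i → shift (T i) 1ₛ) (T l))
  (cong₂ ℤ._+_ (ψ-≢T l (T l) (λ i i<l → ℕₚ.<⇒≢ (T-mono-< i<l))) (shift-1ₛ-at (T l)))
... | inj₁ l<N = trans (∑-suc N (λ i → shift (T i) 1ₛ) (T l))
  (trans (cong₂ ℤ._+_ (ψ-T N l l<N) (shift-1ₛ-off (T N) (T l) (ℕₚ.<⇒≢ (T-mono-< l<N) ∘ sym))) refl)

ψ-at-T : ∀ N {h} l → T l ≡ h → l < N → ψ N h ≡ 1ℤ
ψ-at-T N l refl = ψ-T N l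

ψ-in-gap : ∀ N {h} l r → T l + r ≡ h → 0 < r → r ≤ l → ψ N h ≡ 0ℤ
ψ-in-gap N l r refl 0<r r≤l = ψ-≢T N (T l + r) (λ i _ → T-gap i l r 0<r r≤l)

l<4+k : ∀ l k → T l ≤ 2 + k → l < 4 + k
l<4+k l k T≤ = s≤s (ℕₚ.≤-trans (l≤1+T l) (s≤s T≤))

E-from-ψ : ∀ k {x y z} → ψ (4 + k) (2 + k) ≡ x → ψ (4 + k) (1 + k) ≡ y → ψ (4 + k) k ≡ z →
       E (2 + k) ≡ (x ℤ.+ -1ℤ ℤ.* y) ℤ.+ -1ℤ ℤ.* (y ℤ.+ -1ℤ ℤ.* z)
E-from-ψ k refl refl refl = E≡second-difference (2 + k)

E-at-tri : ∀ l → l ≥ 3 → E (tri l) ≡ + 1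
E-at-tri (suc zero) (s≤s ())
E-at-tri (suc (suc zero)) (s≤s (s≤s ()))
E-at-tri l@(suc (suc (suc j))) _ = trans (cong E (trans (tri≡T l) T≡))
  (E-from-ψ k (ψ-at-T (4 + k) l T≡ (l<4+k l k (ℕₚ.≤-reflexive T≡)))
          (ψ-in-gap (4 + k) l′ l′ (ℕₚ.+-suc (T l′) (suc j)) (s≤s z≤n) ℕₚ.≤-refl)
          (ψ-in-gap (4 + k) l′ (suc j) refl (s≤s z≤n) (ℕₚ.n≤1+n (suc j))))
  where
  l′ = suc (suc j)
  k = T l′ + suc j
  T≡ : T l ≡ 2 + k
  T≡ = lemma (T l′) j
    where
    lemma : ∀ t j → t + 1 * suc (suc j) + 1 ≡ 2 + (t + suc j)
    lemma = ℕ-Solver.solve-∀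

E-at-tri+1 : ∀ l → l ≥ 2 → E (tri l + 1) ≡ - (+ 2)
E-at-tri+1 (suc zero) (s≤s ())
E-at-tri+1 l@(suc (suc j)) _ = trans (cong E m≡)
  (E-from-ψ k (ψ-in-gap (4 + k) l 1 T+1≡ (s≤s z≤n) (s≤s z≤n))
          (ψ-at-T (4 + k) l T≡ (l<4+k l k (ℕₚ.≤-trans (ℕₚ.≤-reflexive T≡) (ℕₚ.n≤1+n _))))
          (ψ-in-gap (4 + k) l′ (suc j) refl (s≤s z≤n) ℕₚ.≤-refl))
  where
  l′ = suc j
  k = T l′ + suc j
  T≡ : T l ≡ 1 + k
  T≡ = lemma (T l′) j
    where
    lemma : ∀ t j → t + 1 * suc j + 1 ≡ 1 + (t + suc j)
    lemma = ℕ-Solver.solve-∀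
  T+1≡ : T l + 1 ≡ 2 + k
  T+1≡ = trans (cong (λ t → t + 1) T≡) (ℕₚ.+-comm (1 + k) 1)
  m≡ : tri l + 1 ≡ 2 + k
  m≡ = trans (cong (λ t → t + 1) (tri≡T l)) T+1≡

E-at-tri+2 : ∀ l → l ≥ 2 → E (tri l + 2) ≡ + 1
E-at-tri+2 (suc zero) (s≤s ())
E-at-tri+2 l@(suc (suc j)) _ = trans (cong E m≡)
  (E-from-ψ (T l) (ψ-in-gap (4 + T l) l 2 (ℕₚ.+-comm (T l) 2) (s≤s z≤n) (s≤s (s≤s z≤n)))
              (ψ-in-gap (4 + T l) l 1 (ℕₚ.+-comm (T l) 1) (s≤s z≤n) (s≤s z≤n))
              (ψ-at-T (4 + T l) l refl (l<4+k l (T l) (ℕₚ.m≤n+m (T l) 2))))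
  where
  m≡ : tri l + 2 ≡ 2 + T l
  m≡ = trans (cong (λ t → t + 2) (tri≡T l)) (ℕₚ.+-comm (T l) 2)

E-off-tri : ∀ m → m ≥ 6 → ¬ (∃[ l ] (l ≥ 3 × (m ≡ tri l ⊎ m ≡ tri l + 1 ⊎ m ≡ tri l + 2))) → E m ≡ + 0
E-off-tri (suc (suc k)) (s≤s (s≤s 4≤k)) not-near-tri =
  E-from-ψ k (ψ-off (2 + k) (ℕₚ.≤-trans 4≤k (ℕₚ.m≤n+m k 2)) T≢2+k)
             (ψ-off (1 + k) (ℕₚ.≤-trans 4≤k (ℕₚ.n≤1+n k)) T≢1+k)
             (ψ-off k 4≤k T≢k)
  where
  ψ-off : ∀ h → 4 ≤ h → (∀ i → 3 ≤ i → T i ≢ h) → ψ (4 + k) h ≡ 0ℤ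
  ψ-off h 4≤h large = ψ-≢T (4 + k) h T≢h
    where
    T≢h : ∀ i → i < 4 + k → T i ≢ h
    T≢h i _ with ℕₚ.<-≤-connex i 3
    ... | inj₁ i<3 = ℕₚ.<⇒≢ (ℕₚ.≤-<-trans (T-mono-≤ (ℕₚ.≤-pred i<3)) 4≤h)
    ... | inj₂ 3≤i = large i 3≤i
  near-tri : ∀ r i {h} → T i ≡ h → r + h ≡ tri i + r
  near-tri r i e = trans (cong (λ t → r + t) (sym e)) (trans (ℕₚ.+-comm r (T i)) (cong (λ t → t + r) (sym (tri≡T i))))
  T≢2+k : ∀ i → 3 ≤ i → T i ≢ 2 + k
  T≢2+k i 3≤i e = not-near-tri (i , 3≤i , inj₁ (trans (sym e) (sym (tri≡T i))))
  T≢1+k : ∀ i → 3 ≤ i → T i ≢ 1 + k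
  T≢1+k i 3≤i e = not-near-tri (i , 3≤i , inj₂ (inj₁ (near-tri 1 i e)))
  T≢k : ∀ i → 3 ≤ i → T i ≢ k
  T≢k i 3≤i e = not-near-tri (i , 3≤i , inj₂ (inj₂ (near-tri 2 i e)))

mainTheorem12 :
    ((m : ℕ) →
      ((∃[ l ] ((l ≡ 0 ⊎ l ≥ 3) × m ≡ tri l)) ⊎ (∃[ l ] (l ≥ 2 × m ≡ tri l + 2))) →
      E m ≡ + 1)
    × ((m : ℕ) → (m ≡ 1 ⊎ m ≡ 2) → E m ≡ - (+ 1))
    × ((m : ℕ) → (∃[ l ] (l ≥ 2 × m ≡ tri l + 1)) → E m ≡ - (+ 2))
    × ((m : ℕ) → m ≥ 6 →
      (¬ (∃[ l ] (l ≥ 3 × (m ≡ tri l ⊎ m ≡ tri l + 1 ⊎ m ≡ tri l + 2)))) →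
      E m ≡ + 0)
mainTheorem12 =
    (λ { _ (inj₁ (_ , inj₁ refl , refl)) → refl
       ; _ (inj₁ (l , inj₂ l≥3 , refl)) → E-at-tri l l≥3
       ; _ (inj₂ (l , l≥2 , refl)) → E-at-tri+2 l l≥2 })
  , (λ { _ (inj₁ refl) → refl ; _ (inj₂ refl) → refl })
  , (λ { _ (l , l≥2 , refl) → E-at-tri+1 l l≥2 })
  , E-off-tri
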